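{- If $\lambda$ is a wide partition with at most two distinct part sizes, then $\lambda$ is Latin.
   Context: For partitions $\alpha,\beta$ of the same integer, $\alpha\ge\beta$ (dominance) means $\sum_{k\le j}\alpha_k\ge\sum_{k\le j}\beta_k$ for all $j$; $\mu'$ is the conjugate of $\mu$. $\mu$ is a subpartition of $\lambda$ if the multiset of parts of $\mu$ is a submultiset of that of $\lambda$. $\lambda$ is wide if $\mu\ge\mu'$ for every subpartition $\mu$ of $\lambda$. A tableau of shape $\lambda$ is the Young diagram of $\lambda$ with a positive integer in each cell. $\lambda$ is Latin if there is a tableau of shape $\lambda$ in which no two cells in the same row or column have equal entries and in which, for every $i$, the integer $i$ occurs exactly $\lambda'_i$ times. -}

module Defs where

open import Data.Nat using (ℕ; zero; suc; _+_; _≤_; _<_; _≤ᵇ_)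
open import Data.Nat.Properties using (_≟_)
open import Data.Bool using (Bool; true; false; if_then_else_)
open import Data.List using (List; []; _∷_; _++_; map; upTo; take)
open import Data.Nat.ListAction using (sum)
open import Data.Sum using (_⊎_)
open import Data.List.Relation.Unary.All using (All)
open import Data.List.Relation.Unary.Linked using (Linked)
open import Data.List.Relation.Binary.Permutation.Propositional using (_↭_)
open import Data.Product using (∃; _×_)
open import Relation.Nullary using (¬_)
open import Relation.Nullary.Decidable using (⌊_⌋)
open import Relation.Binary.PropositionalEquality using (_≡_)

IsPartition : List ℕ → Set
IsPartition l = All (λ x → 0 < x) l × Linked (λ x y → y ≤ x) l

len : List ℕ → ℕ
len [] = 0
len (_ ∷ l) = suc (len l)

-- length of row r (0-indexed), 0 beyond the last row
rowLen : List ℕ → ℕ → ℕ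
rowLen [] _ = 0
rowLen (x ∷ l) zero = x
rowLen (x ∷ l) (suc r) = rowLen l r

firstPart : List ℕ → ℕ
firstPart [] = 0
firstPart (x ∷ _) = x

countBelow : ℕ → (ℕ → Bool) → ℕ
countBelow zero f = 0
countBelow (suc n) f = countBelow n f + (if f n then 1 else 0)

conjAt : List ℕ → ℕ → ℕ
conjAt l i = countBelow (len l) (λ r → i ≤ᵇ rowLen l r)

conj : List ℕ → List ℕ
conj l = map (λ k → conjAt l (suc k)) (upTo (firstPart l))

Dominates : List ℕ → List ℕ → Set
Dominates α β = ∀ j → sum (take j β) ≤ sum (take j α)

-- μ is a subpartition of λ: multiset of parts of μ is a submultiset of that of λ
SubMultiset : List ℕ → List ℕ → Set
SubMultiset μ l = ∃ λ ρ → (μ ++ ρ) ↭ l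

Wide : List ℕ → Set
Wide l = ∀ μ → IsPartition μ → SubMultiset μ l → Dominates μ (conj μ)

AtMostTwoPartSizes : List ℕ → Set
AtMostTwoPartSizes l = ∃ λ a → ∃ λ b → All (λ x → x ≡ a ⊎ x ≡ b) l

InShape : List ℕ → ℕ → ℕ → Set
InShape l r c = r < len l × c < rowLen l r

entryCount : List ℕ → (ℕ → ℕ → ℕ) → ℕ → ℕ
entryCount l T i = sum (map (λ r → countBelow (rowLen l r) (λ c → ⌊ T r c ≟ i ⌋)) (upTo (len l)))

IsLatinTableau : List ℕ → (ℕ → ℕ → ℕ) → Set
IsLatinTableau l T =
  (∀ r c → InShape l r c → 0 < T r c)
  × (∀ r c c' → InShape l r c → InShape l r c' → ¬ (c ≡ c') → ¬ (T r c ≡ T r c'))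
  × (∀ r r' c → InShape l r c → InShape l r' c → ¬ (r ≡ r') → ¬ (T r c ≡ T r' c))
  × (∀ i → 0 < i → entryCount l T i ≡ conjAt l i)

Latin : List ℕ → Set
Latin l = ∃ λ T → IsLatinTableau l T

-- Write λ = (a^m, b^n) with a > b and work with entries 0, …, a − 1 (shifted by one at the very end).
-- Short row t holds c + t mod b in column c.  The long rows must then be permutations of [0, a) that
-- differ pairwise in every column and that avoid, in each column c < b, the n values c + t mod b used
-- below.  It therefore suffices to find a bipartite graph "column c may hold value v" which is regular of
-- some degree M ≥ m and contains none of the pairs (c, c + t mod b): by König's edge-colouring theorem,
-- proved here with Kempe chains, it splits into M perfect matchings, and m of them are the long rows.
-- Every row is then a permutation of its first λ_r values, so each i occurs exactly λ'_i times.
-- Wideness gives m + n = λ'_1 ≤ a and, for the subpartition (b^n), n ≤ b.  If n ≤ a − b, the complement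
-- of two cyclic bands of width n is such a graph, of degree a − n ≥ m.  Otherwise an m-regular staircase
-- graph works; its b × b corner needs room for a band of width m − ⌊m(a − b)/b⌋ above the n forbidden
-- diagonals, and this is exactly the dominance of λ over λ' at j = b: b(m + n) ≤ ma + (b − m)b.

module Submission where

open import Data.Bool using (Bool; true; false; if_then_else_; _∧_; _∨_; not)
open import Data.Bool.Properties using (∧-zeroʳ; ∧-identityʳ; ∨-identityʳ; ∧-distribˡ-∨; ¬-not)
open import Data.Empty using (⊥-elim)
open import Data.Fin using (toℕ; fromℕ<)
import Data.Fin.Properties as Fin
open import Data.List using (List; []; _∷_; _++_; map; upTo; applyUpTo; replicate; take)
open import Data.List.Relation.Unary.All as All using (All; []; _∷_)
import Data.List.Relation.Unary.All.Properties as All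
open import Data.List.Relation.Unary.Linked as Linked using (Linked; []; [-]; _∷_)
open import Data.List.Relation.Binary.Permutation.Propositional using (↭-reflexive)
import Data.List.Relation.Binary.Permutation.Propositional.Properties as Perm
import Data.List.Properties as List
open import Data.Maybe using (Maybe; just; nothing; _>>=_; fromMaybe)
import Data.Maybe.Properties as Maybe
open import Data.Nat
open import Data.Nat.DivMod
open import Data.Nat.ListAction using (sum)
open import Data.Nat.ListAction.Properties using (sum-++)
open import Data.Nat.Properties
open import Data.Nat.Tactic.RingSolver using (solve-∀)
open import Data.Product using (∃; ∃₂; _×_; _,_; proj₁; proj₂)
open import Data.Sum as Sum using (_⊎_; inj₁; inj₂; [_,_]′)
open import Function using (_∘_; id)
open import Relation.Binary.PropositionalEquality
open import Relation.Binary.Definitions using (tri<; tri≈; tri>)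
open import Relation.Nullary using (Dec; yes; no; does; ¬_; contradiction)
open import Relation.Nullary.Decidable using (⌊_⌋; dec-true; dec-false; isYes≗does)
open import Algebra.Properties.CommutativeSemigroup +-commutativeSemigroup using (interchange)

open import Defs

-- Booleans and counting

does⇒ : ∀ {A : Set} (a? : Dec A) → does a? ≡ true → A
does⇒ (yes a) _ = a

does⇒¬ : ∀ {A : Set} (a? : Dec A) → does a? ≡ false → ¬ A
does⇒¬ (no ¬a) _ = ¬a

true≢false : true ≢ false
true≢false ()

not≡true : ∀ {b} → not b ≡ true → b ≡ false
not≡true {false} _ = refl

not≡false : ∀ {b} → not b ≡ false → b ≡ true
not≡false {true} _ = refl

∧≡true⇒ : ∀ {a b} → (a ∧ b) ≡ true → a ≡ true × b ≡ true
∧≡true⇒ {true} {true} _ = refl , refl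

if-true : ∀ {A : Set} {b} {x y : A} → b ≡ true → (if b then x else y) ≡ x
if-true refl = refl

if-false : ∀ {A : Set} {b} {x y : A} → b ≡ false → (if b then x else y) ≡ y
if-false refl = refl

bool-ext : ∀ {a b : Bool} → (a ≡ true → b ≡ true) → (b ≡ true → a ≡ true) → a ≡ b
bool-ext {true} {_} f _ = sym (f refl)
bool-ext {false} {true} _ g = g refl
bool-ext {false} {false} _ _ = refl

module _ {m n : ℕ} where

  ≡ᵇ-sound : (m ≡ᵇ n) ≡ true → m ≡ n
  ≡ᵇ-sound = does⇒ (m ≟ n)

  ≡ᵇ-complete : m ≡ n → (m ≡ᵇ n) ≡ true
  ≡ᵇ-complete = dec-true (m ≟ n)

  ≡ᵇ-false : m ≢ n → (m ≡ᵇ n) ≡ false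
  ≡ᵇ-false = dec-false (m ≟ n)

  ≡ᵇ-false-sound : (m ≡ᵇ n) ≡ false → m ≢ n
  ≡ᵇ-false-sound = does⇒¬ (m ≟ n)

  <ᵇ-complete : m < n → (m <ᵇ n) ≡ true
  <ᵇ-complete = dec-true (m <? n)

  <ᵇ-sound : (m <ᵇ n) ≡ true → m < n
  <ᵇ-sound = does⇒ (m <? n)

  <ᵇ-false : n ≤ m → (m <ᵇ n) ≡ false
  <ᵇ-false n≤m = dec-false (m <? n) (≤⇒≯ n≤m)

  ≤ᵇ-complete : m ≤ n → (m ≤ᵇ n) ≡ true
  ≤ᵇ-complete = dec-true (m ≤? n)

  ≤ᵇ-false : n < m → (m ≤ᵇ n) ≡ false
  ≤ᵇ-false n<m = dec-false (m ≤? n) (<⇒≱ n<m)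

≡ᵇ-refl : ∀ n → (n ≡ᵇ n) ≡ true
≡ᵇ-refl n = ≡ᵇ-complete {n} {n} refl

ind : Bool → ℕ
ind b = if b then 1 else 0

ind≤1 : ∀ b → ind b ≤ 1
ind≤1 true = ≤-refl
ind≤1 false = z≤n

ind-mono : ∀ {b c} → (b ≡ true → c ≡ true) → ind b ≤ ind c
ind-mono {false} _ = z≤n
ind-mono {true} h rewrite h refl = ≤-refl

below-pred : ∀ {n} {P : ℕ → Set} → (∀ k → k < suc n → P k) → ∀ k → k < n → P k
below-pred h k k<n = h k (m<n⇒m<1+n k<n)

countBelow-cong : ∀ n {f g : ℕ → Bool} → (∀ k → k < n → f k ≡ g k) → countBelow n f ≡ countBelow n g
countBelow-cong zero h = refl
countBelow-cong (suc n) h = cong₂ _+_ (countBelow-cong n (below-pred h)) (cong ind (h n ≤-refl))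

countBelow-+ : ∀ x y (f : ℕ → Bool) → countBelow (x + y) f ≡ countBelow x f + countBelow y (λ k → f (x + k))
countBelow-+ x zero f = trans (cong (λ z → countBelow z f) (+-identityʳ x)) (sym (+-identityʳ _))
countBelow-+ x (suc y) f = begin
    countBelow (x + suc y) f                                          ≡⟨ cong (λ z → countBelow z f) (+-suc x y) ⟩
    countBelow (x + y) f + ind (f (x + y))                            ≡⟨ cong (_+ ind (f (x + y))) (countBelow-+ x y f) ⟩
    countBelow x f + countBelow y (λ k → f (x + k)) + ind (f (x + y)) ≡⟨ +-assoc (countBelow x f) _ _ ⟩
    countBelow x f + countBelow (suc y) (λ k → f (x + k))             ∎
  where open ≡-Reasoning

countBelow-allFalse : ∀ n {f : ℕ → Bool} → (∀ k → k < n → f k ≡ false) → countBelow n f ≡ 0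
countBelow-allFalse zero h = refl
countBelow-allFalse (suc n) h rewrite h n ≤-refl = trans (+-identityʳ _) (countBelow-allFalse n (below-pred h))

countBelow-allTrue : ∀ n {f : ℕ → Bool} → (∀ k → k < n → f k ≡ true) → countBelow n f ≡ n
countBelow-allTrue zero h = refl
countBelow-allTrue (suc n) h rewrite h n ≤-refl = trans (+-comm _ 1) (cong suc (countBelow-allTrue n (below-pred h)))

countBelow-unique : ∀ n {f : ℕ → Bool} k₀ → k₀ < n → f k₀ ≡ true → (∀ k → k < n → f k ≡ true → k ≡ k₀) →
                    countBelow n f ≡ 1
countBelow-unique (suc n) {f} k₀ k₀<1+n fk₀ unique with m≤n⇒m<n∨m≡n (s≤s⁻¹ k₀<1+n)
... | inj₂ refl rewrite fk₀ = cong (_+ 1) (countBelow-allFalse n others)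
  where
  others : ∀ k → k < n → f k ≡ false
  others k k<n = ¬-not λ fk → <-irrefl (unique k (m<n⇒m<1+n k<n) fk) k<n
... | inj₁ k₀<n = trans (cong (countBelow n f +_) (cong ind last)) (trans (+-identityʳ _)
                    (countBelow-unique n k₀ k₀<n fk₀ (below-pred unique)))
  where
  last : f n ≡ false
  last = ¬-not λ fn → <-irrefl (sym (unique n ≤-refl fn)) k₀<n

countBelow-mono : ∀ n {f g : ℕ → Bool} → (∀ k → k < n → f k ≡ true → g k ≡ true) → countBelow n f ≤ countBelow n g
countBelow-mono zero h = z≤n
countBelow-mono (suc n) h = +-mono-≤ (countBelow-mono n (below-pred h)) (ind-mono (h n ≤-refl))

countBelow-mono-< : ∀ n {f g : ℕ → Bool} k₀ → k₀ < n → f k₀ ≡ false → g k₀ ≡ true →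
                    (∀ k → k < n → f k ≡ true → g k ≡ true) → countBelow n f < countBelow n g
countBelow-mono-< (suc n) {f} {g} k₀ k₀<1+n fk₀ gk₀ h with m≤n⇒m<n∨m≡n (s≤s⁻¹ k₀<1+n)
... | inj₁ k₀<n = +-mono-<-≤ (countBelow-mono-< n k₀ k₀<n fk₀ gk₀ (below-pred h))
                    (ind-mono (h n ≤-refl))
... | inj₂ refl rewrite fk₀ | gk₀ = +-mono-≤-< (countBelow-mono n (below-pred h)) ≤-refl

countBelow-pos : ∀ n {f : ℕ → Bool} k₀ → k₀ < n → f k₀ ≡ true → 1 ≤ countBelow n f
countBelow-pos (suc n) {f} k₀ k₀<1+n fk₀ with m≤n⇒m<n∨m≡n (s≤s⁻¹ k₀<1+n)
... | inj₁ k₀<n = ≤-trans (countBelow-pos n k₀ k₀<n fk₀) (m≤m+n _ _)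
... | inj₂ refl rewrite fk₀ = m≤n+m 1 _

countBelow-witness : ∀ n (f : ℕ → Bool) → 1 ≤ countBelow n f → ∃ λ k → k < n × f k ≡ true
countBelow-witness (suc n) f h with f n in fn
... | true = n , ≤-refl , fn
... | false with countBelow-witness n f (subst (1 ≤_) (+-identityʳ _) h)
...   | k , k<n , fk = k , m<n⇒m<1+n k<n , fk

countBelow-≤1 : ∀ n (f : ℕ → Bool) → (∀ k k' → k < n → k' < n → f k ≡ true → f k' ≡ true → k ≡ k') →
                countBelow n f ≤ 1
countBelow-≤1 zero f _ = z≤n
countBelow-≤1 (suc n) f unique with f n in fn
... | true = ≤-reflexive (cong (_+ 1) (countBelow-allFalse n others))
  where
  others : ∀ k → k < n → f k ≡ false
  others k k<n = ¬-not λ fk → <-irrefl (unique k n (m<n⇒m<1+n k<n) ≤-refl fk fn) k<n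
... | false = ≤-trans (≤-reflexive (+-identityʳ _))
                (countBelow-≤1 n f λ k k' k<n k'<n → unique k k' (m<n⇒m<1+n k<n) (m<n⇒m<1+n k'<n))

countBelow-split : ∀ {n L} (f : ℕ → Bool) → n ≤ L → countBelow L f ≡ countBelow n f + countBelow (L ∸ n) (λ k → f (n + k))
countBelow-split {n} {L} f n≤L = trans (cong (λ x → countBelow x f) (sym (m+[n∸m]≡n n≤L))) (countBelow-+ n (L ∸ n) f)

countBelow-<ᵇ : ∀ L y → y ≤ L → countBelow L (_<ᵇ y) ≡ y
countBelow-<ᵇ L y y≤L = begin
  countBelow L (_<ᵇ y)                                         ≡⟨ countBelow-split (_<ᵇ y) y≤L ⟩
  countBelow y (_<ᵇ y) + countBelow (L ∸ y) (λ k → y + k <ᵇ y) ≡⟨ cong₂ _+_ (countBelow-allTrue y (λ _ → <ᵇ-complete))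
                                                                    (countBelow-allFalse (L ∸ y) (λ k _ → <ᵇ-false (m≤m+n y k))) ⟩
  y + 0                                                        ≡⟨ +-identityʳ y ⟩
  y                                                            ∎
  where open ≡-Reasoning

countBelow-≤ᵇ : ∀ L n → countBelow L (n ≤ᵇ_) ≡ L ∸ n
countBelow-≤ᵇ L n with n ≤? L
... | no n≰L = trans (countBelow-allFalse L (λ k k<L → ≤ᵇ-false (<-≤-trans k<L (≰⇒≥ n≰L))))
                     (sym (m≤n⇒m∸n≡0 (≰⇒≥ n≰L)))
... | yes n≤L = begin
  countBelow L (n ≤ᵇ_)                                         ≡⟨ countBelow-split (n ≤ᵇ_) n≤L ⟩
  countBelow n (n ≤ᵇ_) + countBelow (L ∸ n) (λ k → n ≤ᵇ n + k) ≡⟨ cong₂ _+_ (countBelow-allFalse n (λ _ → ≤ᵇ-false))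
                                                                    (countBelow-allTrue (L ∸ n) (λ k _ → ≤ᵇ-complete (m≤m+n n k))) ⟩
  L ∸ n                                                        ∎
  where open ≡-Reasoning

sumBelow : ℕ → (ℕ → ℕ) → ℕ
sumBelow zero f = 0
sumBelow (suc n) f = sumBelow n f + f n

sumBelow-cong : ∀ n {f g : ℕ → ℕ} → (∀ k → k < n → f k ≡ g k) → sumBelow n f ≡ sumBelow n g
sumBelow-cong zero h = refl
sumBelow-cong (suc n) h = cong₂ _+_ (sumBelow-cong n (below-pred h)) (h n ≤-refl)

sumBelow-+ : ∀ n (f g : ℕ → ℕ) → sumBelow n (λ k → f k + g k) ≡ sumBelow n f + sumBelow n g
sumBelow-+ zero f g = refl
sumBelow-+ (suc n) f g rewrite sumBelow-+ n f g = interchange (sumBelow n f) (sumBelow n g) (f n) (g n)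

sumBelow-const : ∀ n c → sumBelow n (λ _ → c) ≡ n * c
sumBelow-const zero c = refl
sumBelow-const (suc n) c rewrite sumBelow-const n c = +-comm (n * c) c

sumBelow-ind : ∀ n (f : ℕ → Bool) → sumBelow n (ind ∘ f) ≡ countBelow n f
sumBelow-ind zero f = refl
sumBelow-ind (suc n) f = cong (_+ ind (f n)) (sumBelow-ind n f)

sumBelow-zero : ∀ n {f : ℕ → ℕ} → (∀ k → k < n → f k ≡ 0) → sumBelow n f ≡ 0
sumBelow-zero zero h = refl
sumBelow-zero (suc n) h rewrite h n ≤-refl | sumBelow-zero n (below-pred h) = refl

sumBelow-head : ∀ n (f : ℕ → ℕ) → sumBelow (suc n) f ≡ f 0 + sumBelow n (f ∘ suc)
sumBelow-head zero f = +-comm 0 (f 0)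
sumBelow-head (suc n) f rewrite sumBelow-head n f = +-assoc (f 0) (sumBelow n (f ∘ suc)) (f (suc n))

sumBelow-≥ : ∀ n {f : ℕ → ℕ} → (∀ k → k < n → 1 ≤ f k) → n ≤ sumBelow n f
sumBelow-≥ zero h = z≤n
sumBelow-≥ (suc n) {f} h = subst (_≤ sumBelow n f + f n) (+-comm n 1) (+-mono-≤ (sumBelow-≥ n (below-pred h)) (h n ≤-refl))

sumBelow-≤ : ∀ n {f : ℕ → ℕ} → (∀ k → k < n → f k ≤ 1) → sumBelow n f ≤ n
sumBelow-≤ zero h = z≤n
sumBelow-≤ (suc n) {f} h = subst (sumBelow n f + f n ≤_) (+-comm n 1) (+-mono-≤ (sumBelow-≤ n (below-pred h)) (h n ≤-refl))

sumBelow-≡n⇒all1 : ∀ n {f : ℕ → ℕ} → (∀ k → k < n → f k ≤ 1) → sumBelow n f ≡ n → ∀ k → k < n → f k ≡ 1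
sumBelow-≡n⇒all1 (suc n) {f} h total k k<1+n =
  [ (λ k<n → sumBelow-≡n⇒all1 n (below-pred h) initial k k<n) , (λ { refl → last }) ]′ (m≤n⇒m<n∨m≡n (s≤s⁻¹ k<1+n))
  where
  last : f n ≡ 1
  last = ≤-antisym (h n ≤-refl) (+-cancelʳ-≤ n 1 (f n) (begin
    1 + n                ≡⟨ sym total ⟩
    sumBelow n f + f n   ≤⟨ +-monoˡ-≤ (f n) (sumBelow-≤ n (below-pred h)) ⟩
    n + f n              ≡⟨ +-comm n (f n) ⟩
    f n + n              ∎))
    where open ≤-Reasoning
  initial : sumBelow n f ≡ n
  initial = +-cancelʳ-≡ 1 _ _ (trans (cong (sumBelow n f +_) (sym last)) (trans total (+-comm 1 n)))

countBelow-≡ᵇ : ∀ D x → x < D → countBelow D (x ≡ᵇ_) ≡ 1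
countBelow-≡ᵇ D x x<D = countBelow-unique D x x<D (≡ᵇ-refl x) (λ _ _ e → sym (≡ᵇ-sound e))

countBelow-fibres : ∀ N D (p : ℕ → Bool) (f : ℕ → ℕ) → (∀ j → j < N → p j ≡ true → f j < D) →
                    countBelow N p ≡ sumBelow D (λ α → countBelow N (λ j → p j ∧ (f j ≡ᵇ α)))
countBelow-fibres zero D p f _ = sym (sumBelow-zero D (λ _ _ → refl))
countBelow-fibres (suc N) D p f f< = begin
    countBelow N p + ind (p N)
      ≡⟨ cong₂ _+_ (countBelow-fibres N D p f (below-pred f<)) last ⟩
    sumBelow D (λ α → countBelow N (λ j → p j ∧ (f j ≡ᵇ α))) + sumBelow D (λ α → ind (p N ∧ (f N ≡ᵇ α)))
      ≡⟨ sumBelow-+ D _ _ ⟨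
    sumBelow D (λ α → countBelow (suc N) (λ j → p j ∧ (f j ≡ᵇ α)))
      ∎
  where
  open ≡-Reasoning
  last : ind (p N) ≡ sumBelow D (λ α → ind (p N ∧ (f N ≡ᵇ α)))
  last with p N in pN
  ... | false = sym (sumBelow-zero D (λ _ _ → refl))
  ... | true = sym (trans (sumBelow-ind D (f N ≡ᵇ_)) (countBelow-≡ᵇ D (f N) (f< N ≤-refl pN)))

countBelow-∘-bijection : ∀ b (p : ℕ → Bool) (π ψ : ℕ → ℕ) →
                         (∀ c → c < b → π c < b) → (∀ w → w < b → ψ w < b) →
                         (∀ w → w < b → π (ψ w) ≡ w) → (∀ c → c < b → ψ (π c) ≡ c) →
                         countBelow b (p ∘ π) ≡ countBelow b p
countBelow-∘-bijection b p π ψ π< ψ< πψ ψπ = begin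
    countBelow b (p ∘ π)                                      ≡⟨ countBelow-fibres b b (p ∘ π) π (λ c c<b _ → π< c c<b) ⟩
    sumBelow b (λ w → countBelow b (λ c → p (π c) ∧ (π c ≡ᵇ w))) ≡⟨ sumBelow-cong b fibre ⟩
    sumBelow b (ind ∘ p)                                      ≡⟨ sumBelow-ind b p ⟩
    countBelow b p                                            ∎
  where
  open ≡-Reasoning
  fibre : ∀ w → w < b → countBelow b (λ c → p (π c) ∧ (π c ≡ᵇ w)) ≡ ind (p w)
  fibre w w<b with p w in pw
  ... | true = countBelow-unique b (ψ w) (ψ< w w<b) hit
                 (λ c c<b e → trans (sym (ψπ c c<b)) (cong ψ (≡ᵇ-sound (proj₂ (∧≡true⇒ e)))))
    where
    hit : (p (π (ψ w)) ∧ (π (ψ w) ≡ᵇ w)) ≡ true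
    hit rewrite πψ w w<b | pw = ≡ᵇ-refl w
  ... | false = countBelow-allFalse b miss
    where
    miss : ∀ c → c < b → (p (π c) ∧ (π c ≡ᵇ w)) ≡ false
    miss c _ = ¬-not λ e → let (pπc , πc≡w) = ∧≡true⇒ e in
      true≢false (trans (sym pπc) (trans (cong p (≡ᵇ-sound πc≡w)) pw))

find : ℕ → (ℕ → Bool) → Maybe ℕ
find zero p = nothing
find (suc n) p with find n p
... | just k = just k
... | nothing = if p n then just n else nothing

find-just : ∀ n (p : ℕ → Bool) {k} → find n p ≡ just k → k < n × p k ≡ true
find-just (suc n) p e with find n p in found
find-just (suc n) p refl | just k = let (k<n , pk) = find-just n p found in m<n⇒m<1+n k<n , pk
find-just (suc n) p e | nothing with p n in pn
find-just (suc n) p refl | nothing | true = ≤-refl , pn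

find-nothing : ∀ n (p : ℕ → Bool) → find n p ≡ nothing → ∀ k → k < n → p k ≡ false
find-nothing (suc n) p e k k<1+n with find n p in found
find-nothing (suc n) p e k k<1+n | nothing with p n in pn
find-nothing (suc n) p e k k<1+n | nothing | false =
  [ find-nothing n p found k , (λ { refl → pn }) ]′ (m≤n⇒m<n∨m≡n (s≤s⁻¹ k<1+n))

find-complete : ∀ n (p : ℕ → Bool) k → k < n → p k ≡ true → ∃ λ k' → find n p ≡ just k'
find-complete n p k k<n pk with find n p in found
... | just k' = k' , refl
... | nothing = ⊥-elim (true≢false (trans (sym pk) (find-nothing n p found k k<n)))

pigeonhole : ∀ N (f : ℕ → ℕ) → (∀ k → k ≤ N → f k < N) → ¬ (∀ k k' → k ≤ N → k' ≤ N → f k ≡ f k' → k ≡ k')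
pigeonhole N f f< f-inj with Fin.pigeonhole (n<1+n N) (λ k → fromℕ< (f< (toℕ k) (s≤s⁻¹ (Fin.toℕ<n k))))
... | i , j , i<j , same = <-irrefl (f-inj (toℕ i) (toℕ j) (s≤s⁻¹ (Fin.toℕ<n i)) (s≤s⁻¹ (Fin.toℕ<n j)) f-same) i<j
  where
  f-same : f (toℕ i) ≡ f (toℕ j)
  f-same = trans (sym (Fin.toℕ-fromℕ< _)) (trans (cong toℕ same) (Fin.toℕ-fromℕ< _))

anyBelow : ℕ → (ℕ → Bool) → Bool
anyBelow n p = 0 <ᵇ countBelow n p

anyBelow-intro : ∀ n {p : ℕ → Bool} k → k < n → p k ≡ true → anyBelow n p ≡ true
anyBelow-intro n k k<n pk = <ᵇ-complete (countBelow-pos n k k<n pk)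

anyBelow-elim : ∀ n {p : ℕ → Bool} → anyBelow n p ≡ true → ∃ λ k → k < n × p k ≡ true
anyBelow-elim n {p} e = countBelow-witness n p (<ᵇ-sound e)

anyBelow-false : ∀ n {p : ℕ → Bool} → anyBelow n p ≡ false → ∀ k → k < n → p k ≡ false
anyBelow-false n e k k<n = ¬-not λ pk → true≢false (trans (sym (anyBelow-intro n k k<n pk)) e)

bind-just : ∀ (m : Maybe ℕ) (f : ℕ → Maybe ℕ) {x} → (m >>= f) ≡ just x → ∃ λ y → m ≡ just y × f y ≡ just x
bind-just (just y) f e = y , refl , e

-- Bipartite edge colouring

-- A bipartite graph on two copies of [0, N): left vertex i and right vertex j are adjacent iff E i j.
Edges : Set
Edges = ℕ → ℕ → Bool

transposeᴱ : Edges → Edges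
transposeᴱ E i j = E j i

record ProperColouring (N D : ℕ) (E : Edges) : Set where
  field
    colour : ℕ → ℕ → ℕ
    colour< : ∀ {i j} → i < N → j < N → E i j ≡ true → colour i j < D
    properˡ : ∀ {i j j'} → i < N → j < N → j' < N → E i j ≡ true → E i j' ≡ true → colour i j ≡ colour i j' → j ≡ j'
    properʳ : ∀ {i i' j} → i < N → i' < N → j < N → E i j ≡ true → E i' j ≡ true → colour i j ≡ colour i' j → i ≡ i'

module _ {N D : ℕ} where

  transposeColouring : ∀ {E} → ProperColouring N D E → ProperColouring N D (transposeᴱ E)
  transposeColouring C = record
    { colour = λ i j → colour j i
    ; colour< = λ i<N j<N e → colour< j<N i<N e
    ; properˡ = λ i<N j<N j'<N e e' same → properʳ j<N j'<N i<N e e' same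
    ; properʳ = λ i<N i'<N j<N e e' same → properˡ j<N i<N i'<N e e' same
    }
    where open ProperColouring C

  colouring-cong : ∀ {E F} → (∀ i j → i < N → j < N → E i j ≡ F i j) → ProperColouring N D E → ProperColouring N D F
  colouring-cong E≡F C = record
    { colour = colour
    ; colour< = λ {i} {j} i<N j<N e → colour< i<N j<N (trans (E≡F i j i<N j<N) e)
    ; properˡ = λ {i} {j} {j'} i<N j<N j'<N e e' → properˡ i<N j<N j'<N (trans (E≡F i j i<N j<N) e) (trans (E≡F i j' i<N j'<N) e')
    ; properʳ = λ {i} {i'} {j} i<N i'<N j<N e e' → properʳ i<N i'<N j<N (trans (E≡F i j i<N j<N) e) (trans (E≡F i' j i'<N j<N) e')
    }
    where open ProperColouring C

  emptyColouring : ∀ {E} → (∀ i j → i < N → j < N → E i j ≡ false) → ProperColouring N D E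
  emptyColouring {E} noEdge = record
    { colour = λ _ _ → 0
    ; colour< = λ {i} {j} i<N j<N e → ⊥-elim (absent i<N j<N e)
    ; properˡ = λ {i} {j} i<N j<N _ e _ _ → ⊥-elim (absent i<N j<N e)
    ; properʳ = λ {i} {_} {j} i<N _ j<N e _ _ → ⊥-elim (absent i<N j<N e)
    }
    where
    absent : ∀ {i j} → i < N → j < N → E i j ≢ true
    absent {i} {j} i<N j<N e = true≢false (trans (sym e) (noEdge i j i<N j<N))

  module _ {E} (C : ProperColouring N D E) where
    open ProperColouring C

    hasColour : ℕ → ℕ → ℕ → Bool
    hasColour α i j = E i j ∧ (colour i j ≡ᵇ α)

    missingColour : ∀ u → u < N → countBelow N (E u) < D →
                    ∃ λ α → α < D × (∀ j → j < N → E u j ≡ true → colour u j ≢ α)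
    missingColour u u<N deg<D with find D (λ α → not (anyBelow N (hasColour α u))) in found
    ... | just α = α , proj₁ (find-just D _ found) , absent
      where
      absent : ∀ j → j < N → E u j ≡ true → colour u j ≢ α
      absent j j<N e refl = true≢false (trans (sym (cong₂ _∧_ e (≡ᵇ-refl (colour u j))))
                              (anyBelow-false N (not≡true (proj₂ (find-just D _ found))) j j<N))
    ... | nothing = contradiction deg<D (≤⇒≯ allPresent)
      where
      present : ∀ α → α < D → 1 ≤ countBelow N (hasColour α u)
      present α α<D = <ᵇ-sound (not≡false (find-nothing D _ found α α<D))
      allPresent : D ≤ countBelow N (E u)
      allPresent = ≤-trans (sumBelow-≥ D present)
                     (≤-reflexive (sym (countBelow-fibres N D (E u) (colour u) (λ j j<N e → colour< u<N j<N e))))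

    everyColour : ∀ u → u < N → countBelow N (E u) ≡ D → ∀ α → α < D → ∃ λ j → j < N × hasColour α u j ≡ true
    everyColour u u<N deg≡D α α<D =
      countBelow-witness N (hasColour α u) (≤-reflexive (sym (sumBelow-≡n⇒all1 D atMostOne total α α<D)))
      where
      atMostOne : ∀ α → α < D → countBelow N (hasColour α u) ≤ 1
      atMostOne α _ = countBelow-≤1 N (hasColour α u) λ j j' j<N j'<N e e' →
        let (euj , cα) = ∧≡true⇒ e ; (euj' , c'α) = ∧≡true⇒ e' in
        properˡ u<N j<N j'<N euj euj' (trans (≡ᵇ-sound cα) (sym (≡ᵇ-sound c'α)))
      total : sumBelow D (λ α → countBelow N (hasColour α u)) ≡ D
      total = trans (sym (countBelow-fibres N D (E u) (colour u) (λ j j<N e → colour< u<N j<N e))) deg≡D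

addEdge : Edges → ℕ → ℕ → Edges
addEdge E u v i j = E i j ∨ ((i ≡ᵇ u) ∧ (j ≡ᵇ v))

module _ {N D : ℕ} {E : Edges} (C : ProperColouring N D E) {u v α : ℕ} (u<N : u < N) (v<N : v < N) (α<D : α < D)
         (α∉u : ∀ j → j < N → E u j ≡ true → ProperColouring.colour C u j ≢ α)
         (α∉v : ∀ i → i < N → E i v ≡ true → ProperColouring.colour C i v ≢ α) where
  open ProperColouring C

  private
    isNew : ℕ → ℕ → Bool
    isNew i j = (i ≡ᵇ u) ∧ (j ≡ᵇ v)

    colour′ : ℕ → ℕ → ℕ
    colour′ i j = if isNew i j then α else colour i j

    data Kind (i j : ℕ) : Set where
      new : i ≡ u → j ≡ v → colour′ i j ≡ α → Kind i j
      old : isNew i j ≡ false → colour′ i j ≡ colour i j → Kind i j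

    kind : ∀ i j → Kind i j
    kind i j with isNew i j in n
    ... | true = let (i≡u , j≡v) = ∧≡true⇒ n in new (≡ᵇ-sound i≡u) (≡ᵇ-sound j≡v) (if-true n)
    ... | false = old n (if-false n)

    oldEdge : ∀ {i j} → addEdge E u v i j ≡ true → isNew i j ≡ false → E i j ≡ true
    oldEdge {i} {j} e n = trans (sym (∨-identityʳ (E i j))) (trans (cong (E i j ∨_) (sym n)) e)

  colourNewEdge : ProperColouring N D (addEdge E u v)
  colourNewEdge = record { colour = colour′ ; colour< = colour<′ ; properˡ = properˡ′ ; properʳ = properʳ′ }
    where
    colour<′ : ∀ {i j} → i < N → j < N → addEdge E u v i j ≡ true → colour′ i j < D
    colour<′ {i} {j} i<N j<N e with kind i j
    ... | new _ _ c = subst (_< D) (sym c) α<D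
    ... | old n c = subst (_< D) (sym c) (colour< i<N j<N (oldEdge e n))
    properˡ′ : ∀ {i j j'} → i < N → j < N → j' < N → addEdge E u v i j ≡ true → addEdge E u v i j' ≡ true →
               colour′ i j ≡ colour′ i j' → j ≡ j'
    properˡ′ {i} {j} {j'} i<N j<N j'<N e e' same with kind i j | kind i j'
    ... | new _ j≡v _ | new _ j'≡v _ = trans j≡v (sym j'≡v)
    ... | new refl _ c | old n' c' = ⊥-elim (α∉u j' j'<N (oldEdge e' n') (trans (sym c') (trans (sym same) c)))
    ... | old n c | new refl _ c' = ⊥-elim (α∉u j j<N (oldEdge e n) (trans (sym c) (trans same c')))
    ... | old n c | old n' c' = properˡ i<N j<N j'<N (oldEdge e n) (oldEdge e' n') (trans (sym c) (trans same c'))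
    properʳ′ : ∀ {i i' j} → i < N → i' < N → j < N → addEdge E u v i j ≡ true → addEdge E u v i' j ≡ true →
               colour′ i j ≡ colour′ i' j → i ≡ i'
    properʳ′ {i} {i'} {j} i<N i'<N j<N e e' same with kind i j | kind i' j
    ... | new i≡u _ _ | new i'≡u _ _ = trans i≡u (sym i'≡u)
    ... | new _ refl c | old n' c' = ⊥-elim (α∉v i' i'<N (oldEdge e' n') (trans (sym c') (trans (sym same) c)))
    ... | old n c | new _ refl c' = ⊥-elim (α∉v i i<N (oldEdge e n) (trans (sym c) (trans same c')))
    ... | old n c | old n' c' = properʳ i<N i'<N j<N (oldEdge e n) (oldEdge e' n') (trans (sym c) (trans same c'))

module Transposition (α β : ℕ) where

  swap : ℕ → ℕ
  swap c = if c ≡ᵇ α then β else (if c ≡ᵇ β then α else c)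

  data View (c : ℕ) : Set where
    is-α : c ≡ α → swap c ≡ β → View c
    is-β : c ≡ β → swap c ≡ α → View c
    other : c ≢ α → c ≢ β → swap c ≡ c → View c

  view : ∀ c → View c
  view c with c ≡ᵇ α in cα
  ... | true = is-α (≡ᵇ-sound cα) (if-true cα)
  ... | false with c ≡ᵇ β in cβ
  ...   | true = is-β (≡ᵇ-sound cβ) (trans (if-false cα) (if-true cβ))
  ...   | false = other (≡ᵇ-false-sound cα) (≡ᵇ-false-sound cβ) (trans (if-false cα) (if-false cβ))

  swap-involutive : ∀ c → swap (swap c) ≡ c
  swap-involutive c with view c
  ... | other _ _ s = trans (cong swap s) s
  ... | is-α refl s rewrite s with view β
  ...   | is-α β≡α s' = trans s' β≡α
  ...   | is-β _ s' = s'
  ...   | other _ β≢β _ = contradiction refl β≢β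
  swap-involutive c | is-β refl s rewrite s with view α
  ...   | is-α _ s' = s'
  ...   | is-β α≡β s' = trans s' α≡β
  ...   | other α≢α _ _ = contradiction refl α≢α

  swap-injective : ∀ {c c'} → swap c ≡ swap c' → c ≡ c'
  swap-injective {c} {c'} e = trans (sym (swap-involutive c)) (trans (cong swap e) (swap-involutive c'))

  swap-< : ∀ {D c} → α < D → β < D → c < D → swap c < D
  swap-< {D} {c} α<D β<D c<D with view c
  ... | is-α _ s = subst (_< D) (sym s) β<D
  ... | is-β _ s = subst (_< D) (sym s) α<D
  ... | other _ _ s = subst (_< D) (sym s) c<D

  swap≡α : ∀ c → swap c ≡ α → c ≡ β
  swap≡α c e with view c
  ... | is-α c≡α s = trans c≡α (trans (sym e) s)
  ... | is-β c≡β _ = c≡β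
  ... | other c≢α _ s = contradiction (trans (sym s) e) c≢α

-- Follow the path from v that alternately uses α- and β-edges and swap α
-- and β at every left vertex it visits; as α- and β-edges never leave the path, this recolours exactly the path.
-- Afterwards α is missing at v, and still at u: the path enters left vertices through α-edges.
module KempeChain {N D : ℕ} {E : Edges} (C : ProperColouring N D E) {u v α β : ℕ}
                  (u<N : u < N) (v<N : v < N) (α<D : α < D) (β<D : β < D)
                  (α∉u : ∀ j → j < N → E u j ≡ true → ProperColouring.colour C u j ≢ α)
                  (β∉v : ∀ i → i < N → E i v ≡ true → ProperColouring.colour C i v ≢ β) where
  open ProperColouring C
  open Transposition α β

  neighbourˡ : ℕ → ℕ → Maybe ℕ
  neighbourˡ c j = find N (λ i → hasColour C c i j)

  neighbourʳ : ℕ → ℕ → Maybe ℕ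
  neighbourʳ c i = find N (hasColour C c i)

  chainʳ : ℕ → Maybe ℕ
  chainˡ : ℕ → Maybe ℕ
  chainʳ zero = just v
  chainʳ (suc k) = chainˡ k >>= neighbourʳ β
  chainˡ k = chainʳ k >>= neighbourˡ α

  hasColour⇒ : ∀ {c i j} → hasColour C c i j ≡ true → E i j ≡ true × colour i j ≡ c
  hasColour⇒ e = let (eij , cij) = ∧≡true⇒ e in eij , ≡ᵇ-sound cij

  chainˡ-step : ∀ k {i} → chainˡ k ≡ just i → ∃ λ j → chainʳ k ≡ just j × i < N × E i j ≡ true × colour i j ≡ α
  chainˡ-step k e with bind-just (chainʳ k) (neighbourˡ α) e
  ... | j , r , found = let (i<N , h) = find-just N _ found in j , r , i<N , hasColour⇒ h

  chainʳ-step : ∀ k {j} → chainʳ (suc k) ≡ just j → ∃ λ i → chainˡ k ≡ just i × j < N × E i j ≡ true × colour i j ≡ β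
  chainʳ-step k e with bind-just (chainˡ k) (neighbourʳ β) e
  ... | i , l , found = let (j<N , h) = find-just N _ found in i , l , j<N , hasColour⇒ h

  chainʳ< : ∀ k {j} → chainʳ k ≡ just j → j < N
  chainʳ< zero refl = v<N
  chainʳ< (suc k) e = proj₁ (proj₂ (proj₂ (chainʳ-step k e)))

  chainˡ< : ∀ k {i} → chainˡ k ≡ just i → i < N
  chainˡ< k e = proj₁ (proj₂ (proj₂ (chainˡ-step k e)))

  chainʳ-injective : ∀ k k' {j} → chainʳ k ≡ just j → chainʳ k' ≡ just j → k ≡ k'
  chainˡ-injective : ∀ k k' {i} → chainˡ k ≡ just i → chainˡ k' ≡ just i → k ≡ k'
  chainʳ-injective zero zero _ _ = refl
  chainʳ-injective zero (suc k') refl e' =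
    let (i , l , _ , eiv , β≡) = chainʳ-step k' e' in contradiction β≡ (β∉v i (chainˡ< k' l) eiv)
  chainʳ-injective (suc k) zero e refl =
    let (i , l , _ , eiv , β≡) = chainʳ-step k e in contradiction β≡ (β∉v i (chainˡ< k l) eiv)
  chainʳ-injective (suc k) (suc k') e e' =
    let (i , l , j<N , eij , cβ) = chainʳ-step k e
        (i' , l' , _ , ei'j , c'β) = chainʳ-step k' e'
        i≡i' = properʳ (chainˡ< k l) (chainˡ< k' l') j<N eij ei'j (trans cβ (sym c'β))
    in cong suc (chainˡ-injective k k' l (subst (λ x → chainˡ k' ≡ just x) (sym i≡i') l'))
  chainˡ-injective k k' e e' =
    let (j , r , i<N , eij , cα) = chainˡ-step k e
        (j' , r' , _ , eij' , c'α) = chainˡ-step k' e'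
        j≡j' = properˡ i<N (chainʳ< k r) (chainʳ< k' r') eij eij' (trans cα (sym c'α))
    in chainʳ-injective k k' r (subst (λ x → chainʳ k' ≡ just x) (sym j≡j') r')

  chainʳ-defined-below : ∀ k t {j} → chainʳ (k + t) ≡ just j → ∃ λ j' → chainʳ k ≡ just j'
  chainʳ-defined-below k zero {j} e = j , subst (λ x → chainʳ x ≡ just j) (+-identityʳ k) e
  chainʳ-defined-below k (suc t) {j} e =
    let (_ , l , _) = chainʳ-step (k + t) (subst (λ x → chainʳ x ≡ just j) (+-suc k t) e)
        (_ , r , _) = chainˡ-step (k + t) l
    in chainʳ-defined-below k t r

  chainʳ-terminates : chainʳ N ≡ nothing
  chainʳ-terminates with chainʳ N in e
  ... | nothing = refl
  ... | just j = ⊥-elim (pigeonhole N position position< position-injective)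
    where
    position : ℕ → ℕ
    position k = fromMaybe 0 (chainʳ k)
    defined : ∀ k → k ≤ N → chainʳ k ≡ just (position k)
    defined k k≤N with chainʳ-defined-below k (N ∸ k) (subst (λ x → chainʳ x ≡ just j) (sym (m+[n∸m]≡n k≤N)) e)
    ... | _ , r rewrite r = refl
    position< : ∀ k → k ≤ N → position k < N
    position< k k≤N = chainʳ< k (defined k k≤N)
    position-injective : ∀ k k' → k ≤ N → k' ≤ N → position k ≡ position k' → k ≡ k'
    position-injective k k' k≤N k'≤N same =
      chainʳ-injective k k' (defined k k≤N) (subst (λ x → chainʳ k' ≡ just x) (sym same) (defined k' k'≤N))

  chainʳ-length : ∀ k {j} → chainʳ k ≡ just j → k < N
  chainʳ-length k {j} e with k <? N
  ... | yes k<N = k<N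
  ... | no k≮N with chainʳ-defined-below N (k ∸ N) (subst (λ x → chainʳ x ≡ just j) (sym (m+[n∸m]≡n (≮⇒≥ k≮N))) e)
  ...   | _ , r with () ← trans (sym r) chainʳ-terminates

  chainˡ-length : ∀ k {i} → chainˡ k ≡ just i → k < N
  chainˡ-length k e = let (_ , r , _) = chainˡ-step k e in chainʳ-length k r

  _is_ : Maybe ℕ → ℕ → Bool
  m is x = does (Maybe.≡-dec _≟_ m (just x))

  onChainʳ : ℕ → Bool
  onChainʳ j = anyBelow N (λ k → chainʳ k is j)

  onChainˡ : ℕ → Bool
  onChainˡ i = anyBelow N (λ k → chainˡ k is i)

  onChainʳ-intro : ∀ k {j} → chainʳ k ≡ just j → onChainʳ j ≡ true
  onChainʳ-intro k e = anyBelow-intro N k (chainʳ-length k e) (dec-true (Maybe.≡-dec _≟_ _ _) e)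

  onChainˡ-intro : ∀ k {i} → chainˡ k ≡ just i → onChainˡ i ≡ true
  onChainˡ-intro k e = anyBelow-intro N k (chainˡ-length k e) (dec-true (Maybe.≡-dec _≟_ _ _) e)

  onChainʳ-elim : ∀ {j} → onChainʳ j ≡ true → ∃ λ k → chainʳ k ≡ just j
  onChainʳ-elim e = let (k , _ , h) = anyBelow-elim N e in k , does⇒ (Maybe.≡-dec _≟_ _ _) h

  onChainˡ-elim : ∀ {i} → onChainˡ i ≡ true → ∃ λ k → chainˡ k ≡ just i
  onChainˡ-elim e = let (k , _ , h) = anyBelow-elim N e in k , does⇒ (Maybe.≡-dec _≟_ _ _) h

  hasColour-intro : ∀ {c i j} → E i j ≡ true → colour i j ≡ c → hasColour C c i j ≡ true
  hasColour-intro {c} eij refl = cong₂ _∧_ eij (≡ᵇ-refl c)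

  α-edge-closed : ∀ {i j} → i < N → j < N → E i j ≡ true → colour i j ≡ α → onChainˡ i ≡ onChainʳ j
  α-edge-closed {i} {j} i<N j<N eij cα = bool-ext forward backward
    where
    forward : onChainˡ i ≡ true → onChainʳ j ≡ true
    forward h =
      let (k , l) = onChainˡ-elim h
          (j' , r , _ , eij' , c'α) = chainˡ-step k l
          j≡j' = properˡ i<N j<N (chainʳ< k r) eij eij' (trans cα (sym c'α))
      in onChainʳ-intro k (subst (λ x → chainʳ k ≡ just x) (sym j≡j') r)
    backward : onChainʳ j ≡ true → onChainˡ i ≡ true
    backward h =
      let (k , r) = onChainʳ-elim h
          (i' , found) = find-complete N (λ x → hasColour C α x j) i i<N (hasColour-intro eij cα)
          (i'<N , h') = find-just N _ found
          (ei'j , c'α) = hasColour⇒ h'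
          i'≡i = properʳ i'<N i<N j<N ei'j eij (trans c'α (sym cα))
      in onChainˡ-intro k (trans (cong (_>>= neighbourˡ α) r) (trans found (cong just i'≡i)))

  β-edge-closed : ∀ {i j} → i < N → j < N → E i j ≡ true → colour i j ≡ β → onChainˡ i ≡ onChainʳ j
  β-edge-closed {i} {j} i<N j<N eij cβ = bool-ext forward backward
    where
    forward : onChainˡ i ≡ true → onChainʳ j ≡ true
    forward h =
      let (k , l) = onChainˡ-elim h
          (j' , found) = find-complete N (hasColour C β i) j j<N (hasColour-intro eij cβ)
          (j'<N , h') = find-just N _ found
          (eij' , c'β) = hasColour⇒ h'
          j'≡j = properˡ i<N j'<N j<N eij' eij (trans c'β (sym cβ))
      in onChainʳ-intro (suc k) (trans (cong (_>>= neighbourʳ β) l) (trans found (cong just j'≡j)))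
    backward : onChainʳ j ≡ true → onChainˡ i ≡ true
    backward h with onChainʳ-elim h
    ... | zero , refl = contradiction cβ (β∉v i i<N eij)
    ... | suc k , r =
      let (i' , l , _ , ei'j , c'β) = chainʳ-step k r
          i'≡i = properʳ (chainˡ< k l) i<N j<N ei'j eij (trans c'β (sym cβ))
      in onChainˡ-intro k (subst (λ x → chainˡ k ≡ just x) i'≡i l)

  u-off-chain : onChainˡ u ≡ false
  u-off-chain = ¬-not λ h →
    let (k , l) = onChainˡ-elim h
        (j , r , _ , euj , cα) = chainˡ-step k l
    in α∉u j (chainʳ< k r) euj cα

  v-on-chain : onChainʳ v ≡ true
  v-on-chain = onChainʳ-intro zero refl

  private
    colour₂ : ℕ → ℕ → ℕ
    colour₂ i j = if onChainˡ i then swap (colour i j) else colour i j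

    data Row (i j : ℕ) : Set where
      swapped : onChainˡ i ≡ true → colour₂ i j ≡ swap (colour i j) → Row i j
      kept : onChainˡ i ≡ false → colour₂ i j ≡ colour i j → Row i j

    row : ∀ i j → Row i j
    row i j with onChainˡ i in o
    ... | true = swapped o (if-true o)
    ... | false = kept o (if-false o)

    swapped-vs-kept : ∀ {i i' j} → i < N → i' < N → j < N → E i j ≡ true → E i' j ≡ true →
                      onChainˡ i ≡ true → onChainˡ i' ≡ false → swap (colour i j) ≡ colour i' j → i ≡ i'
    swapped-vs-kept {i} {i'} {j} i<N i'<N j<N eij ei'j on off same with view (colour i j)
    ... | is-α cα s = contradiction (trans (sym on) (trans (α-edge-closed i<N j<N eij cα)
                        (trans (sym (β-edge-closed i'<N j<N ei'j (trans (sym same) s))) off))) true≢false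
    ... | is-β cβ s = contradiction (trans (sym on) (trans (β-edge-closed i<N j<N eij cβ)
                        (trans (sym (α-edge-closed i'<N j<N ei'j (trans (sym same) s))) off))) true≢false
    ... | other _ _ s = properʳ i<N i'<N j<N eij ei'j (trans (sym s) same)

  swappedColouring : ProperColouring N D E
  swappedColouring = record { colour = colour₂ ; colour< = colour<₂ ; properˡ = properˡ₂ ; properʳ = properʳ₂ }
    where
    colour<₂ : ∀ {i j} → i < N → j < N → E i j ≡ true → colour₂ i j < D
    colour<₂ {i} {j} i<N j<N e with row i j
    ... | swapped _ c = subst (_< D) (sym c) (swap-< α<D β<D (colour< i<N j<N e))
    ... | kept _ c = subst (_< D) (sym c) (colour< i<N j<N e)
    properˡ₂ : ∀ {i j j'} → i < N → j < N → j' < N → E i j ≡ true → E i j' ≡ true → colour₂ i j ≡ colour₂ i j' → j ≡ j'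
    properˡ₂ {i} {j} {j'} i<N j<N j'<N e e' same with row i j | row i j'
    ... | swapped _ c | swapped _ c' = properˡ i<N j<N j'<N e e' (swap-injective (trans (sym c) (trans same c')))
    ... | kept _ c | kept _ c' = properˡ i<N j<N j'<N e e' (trans (sym c) (trans same c'))
    ... | swapped on _ | kept off _ = contradiction (trans (sym on) off) true≢false
    ... | kept off _ | swapped on _ = contradiction (trans (sym on) off) true≢false
    properʳ₂ : ∀ {i i' j} → i < N → i' < N → j < N → E i j ≡ true → E i' j ≡ true → colour₂ i j ≡ colour₂ i' j → i ≡ i'
    properʳ₂ {i} {i'} {j} i<N i'<N j<N e e' same with row i j | row i' j
    ... | swapped _ c | swapped _ c' = properʳ i<N i'<N j<N e e' (swap-injective (trans (sym c) (trans same c')))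
    ... | kept _ c | kept _ c' = properʳ i<N i'<N j<N e e' (trans (sym c) (trans same c'))
    ... | swapped on c | kept off c' = swapped-vs-kept i<N i'<N j<N e e' on off (trans (sym c) (trans same c'))
    ... | kept off c | swapped on c' = sym (swapped-vs-kept i'<N i<N j<N e' e on off (trans (sym c') (trans (sym same) c)))

  α∉u₂ : ∀ j → j < N → E u j ≡ true → colour₂ u j ≢ α
  α∉u₂ j j<N euj with row u j
  ... | swapped on _ = λ _ → true≢false (trans (sym on) u-off-chain)
  ... | kept _ c = λ c₂α → α∉u j j<N euj (trans (sym c) c₂α)

  α∉v₂ : ∀ i → i < N → E i v ≡ true → colour₂ i v ≢ α
  α∉v₂ i i<N eiv with row i v
  ... | swapped _ c = λ c₂α → β∉v i i<N eiv (swap≡α _ (trans (sym c) c₂α))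
  ... | kept off c = λ c₂α → true≢false (trans (sym v-on-chain) (trans (sym (α-edge-closed i<N v<N eiv (trans (sym c) c₂α))) off))

module _ {N D : ℕ} {E : Edges} (C : ProperColouring N D E) {u v : ℕ} (u<N : u < N) (v<N : v < N) where

  extendColouring : countBelow N (E u) < D → countBelow N (transposeᴱ E v) < D → ProperColouring N D (addEdge E u v)
  extendColouring deg-u<D deg-v<D =
    let (α , α<D , α∉u) = missingColour C u u<N deg-u<D
        (β , β<D , β∉v) = missingColour (transposeColouring C) v v<N deg-v<D
        open KempeChain C u<N v<N α<D β<D α∉u β∉v
    in colourNewEdge swappedColouring u<N v<N α<D α∉u₂ α∉v₂

<ᵇ-suc : ∀ k t → (k <ᵇ suc t) ≡ ((k <ᵇ t) ∨ (k ≡ᵇ t))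
<ᵇ-suc zero zero = refl
<ᵇ-suc zero (suc t) = refl
<ᵇ-suc (suc k) zero = refl
<ᵇ-suc (suc k) (suc t) = <ᵇ-suc k t

module _ (N D : ℕ) .{{_ : NonZero N}} (E : Edges)
         (degˡ : ∀ i → i < N → countBelow N (E i) ≤ D) (degʳ : ∀ j → j < N → countBelow N (transposeᴱ E j) ≤ D) where

  private
    index : ℕ → ℕ → ℕ
    index i j = i * N + j

    index-div-mod : ∀ t → index (t / N) (t % N) ≡ t
    index-div-mod t = trans (+-comm (t / N * N) (t % N)) (sym (m≡m%n+[m/n]*n t N))

    index-injective : ∀ i j t → j < N → index i j ≡ t → i ≡ t / N × j ≡ t % N
    index-injective i j t j<N refl = i≡ , j≡
      where
      j≡ : j ≡ index i j % N
      j≡ = sym (trans (cong (_% N) (+-comm (i * N) j)) (trans ([m+kn]%n≡m%n j i N) (m<n⇒m%n≡m j<N)))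
      i≡ : i ≡ index i j / N
      i≡ = *-cancelʳ-≡ i _ N (+-cancelʳ-≡ j _ _ (sym (trans (cong (index i j / N * N +_) j≡) (index-div-mod (index i j)))))

    index< : ∀ {i j} → i < N → j < N → index i j < N * N
    index< {i} {j} i<N j<N = begin-strict
      i * N + j  <⟨ +-monoʳ-< (i * N) j<N ⟩
      i * N + N  ≡⟨ +-comm (i * N) N ⟩
      suc i * N  ≤⟨ *-monoˡ-≤ N i<N ⟩
      N * N      ∎
      where open ≤-Reasoning

    firstEdges : ℕ → Edges
    firstEdges t i j = E i j ∧ (index i j <ᵇ t)

    isNext : ℕ → ℕ → ℕ → Bool
    isNext t i j = (i ≡ᵇ t / N) ∧ (j ≡ᵇ t % N)

    index≡ᵇ : ∀ t i j → j < N → (index i j ≡ᵇ t) ≡ isNext t i j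
    index≡ᵇ t i j j<N = bool-ext forward backward
      where
      forward : (index i j ≡ᵇ t) ≡ true → isNext t i j ≡ true
      forward e = let (i≡ , j≡) = index-injective i j t j<N (≡ᵇ-sound e) in
        cong₂ _∧_ (≡ᵇ-complete {i} i≡) (≡ᵇ-complete {j} j≡)
      backward : isNext t i j ≡ true → (index i j ≡ᵇ t) ≡ true
      backward e = let (i≡ , j≡) = ∧≡true⇒ {i ≡ᵇ t / N} e in
        ≡ᵇ-complete {index i j} (trans (cong₂ index (≡ᵇ-sound {i} i≡) (≡ᵇ-sound {j} j≡)) (index-div-mod t))

    firstEdges-suc : ∀ t {b} → E (t / N) (t % N) ≡ b → ∀ i j → j < N →
                     firstEdges (suc t) i j ≡ firstEdges t i j ∨ (b ∧ isNext t i j)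
    firstEdges-suc t {b} e-next i j j<N rewrite <ᵇ-suc (index i j) t =
      trans (∧-distribˡ-∨ (E i j) _ _) (cong (firstEdges t i j ∨_) (trans next-edge (cong (_∧ isNext t i j) e-next)))
      where
      next-edge : (E i j ∧ (index i j ≡ᵇ t)) ≡ (E (t / N) (t % N) ∧ isNext t i j)
      next-edge rewrite index≡ᵇ t i j j<N with isNext t i j in n
      ... | true = let (i≡ , j≡) = ∧≡true⇒ n in cong (_∧ true) (cong₂ E (≡ᵇ-sound i≡) (≡ᵇ-sound j≡))
      ... | false = trans (∧-zeroʳ (E i j)) (sym (∧-zeroʳ _))

    colourFirst : ∀ t → t ≤ N * N → ProperColouring N D (firstEdges t)
    colourFirst zero _ = emptyColouring (λ i j _ _ → ∧-zeroʳ (E i j))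
    colourFirst (suc t) t<N*N with E (t / N) (t % N) in e-next
    ... | false = colouring-cong (λ i j _ j<N → sym (trans (firstEdges-suc t e-next i j j<N) (∨-identityʳ _)))
                    (colourFirst t (<⇒≤ t<N*N))
    ... | true = colouring-cong (λ i j _ j<N → sym (firstEdges-suc t e-next i j j<N))
                   (extendColouring (colourFirst t (<⇒≤ t<N*N)) u<N v<N deg-u deg-v)
      where
      u = t / N
      v = t % N
      u<N : u < N
      u<N = m<n*o⇒m/o<n t<N*N
      v<N : v < N
      v<N = m%n<n t N
      not-yet : firstEdges t u v ≡ false
      not-yet = trans (cong (E u v ∧_) (trans (cong (_<ᵇ t) (index-div-mod t)) (<ᵇ-false {t} ≤-refl))) (∧-zeroʳ (E u v))
      deg-u : countBelow N (firstEdges t u) < D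
      deg-u = <-≤-trans (countBelow-mono-< N v v<N not-yet e-next (λ _ _ e → proj₁ (∧≡true⇒ e))) (degˡ u u<N)
      deg-v : countBelow N (transposeᴱ (firstEdges t) v) < D
      deg-v = <-≤-trans (countBelow-mono-< N u u<N not-yet e-next (λ _ _ e → proj₁ (∧≡true⇒ e))) (degʳ v v<N)

  königColouring : ProperColouring N D E
  königColouring = colouring-cong all (colourFirst (N * N) ≤-refl)
    where
    all : ∀ i j → i < N → j < N → firstEdges (N * N) i j ≡ E i j
    all i j i<N j<N = trans (cong (E i j ∧_) (<ᵇ-complete (index< i<N j<N))) (∧-identityʳ (E i j))

-- Cyclic shifts

[m%n+k]%n≡[m+k]%n : ∀ m k n .{{_ : NonZero n}} → (m % n + k) % n ≡ (m + k) % n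
[m%n+k]%n≡[m+k]%n m k n = begin
  (m % n + k) % n          ≡⟨ %-distribˡ-+ (m % n) k n ⟩
  (m % n % n + k % n) % n  ≡⟨ cong (λ x → (x + k % n) % n) (m%n%n≡m%n m n) ⟩
  (m % n + k % n) % n      ≡⟨ %-distribˡ-+ m k n ⟨
  (m + k) % n              ∎
  where open ≡-Reasoning

module Cyclic (B : ℕ) .{{_ : NonZero B}} where

  infixl 6 _⊕_ _⊖_

  _⊕_ : ℕ → ℕ → ℕ
  x ⊕ y = (x + y) % B

  _⊖_ : ℕ → ℕ → ℕ
  x ⊖ y = (x + (B ∸ y)) % B

  ⊕< : ∀ x y → x ⊕ y < B
  ⊕< x y = m%n<n (x + y) B

  ⊖< : ∀ x y → x ⊖ y < B
  ⊖< x y = m%n<n (x + (B ∸ y)) B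

  ⊕-comm : ∀ x y → x ⊕ y ≡ y ⊕ x
  ⊕-comm x y = cong (_% B) (+-comm x y)

  +-B%B : ∀ x → x < B → (x + B) % B ≡ x
  +-B%B x x<B = trans ([m+n]%n≡m%n x B) (m<n⇒m%n≡m x<B)

  ⊕-⊖ : ∀ x y → x < B → y ≤ B → x ⊕ y ⊖ y ≡ x
  ⊕-⊖ x y x<B y≤B = begin
    ((x + y) % B + (B ∸ y)) % B  ≡⟨ [m%n+k]%n≡[m+k]%n (x + y) (B ∸ y) B ⟩
    (x + y + (B ∸ y)) % B        ≡⟨ cong (_% B) (trans (+-assoc x y _) (cong (x +_) (m+[n∸m]≡n y≤B))) ⟩
    (x + B) % B                  ≡⟨ +-B%B x x<B ⟩
    x                            ∎
    where open ≡-Reasoning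

  ⊖-⊕ : ∀ x y → x < B → y ≤ B → x ⊖ y ⊕ y ≡ x
  ⊖-⊕ x y x<B y≤B = begin
    ((x + (B ∸ y)) % B + y) % B  ≡⟨ [m%n+k]%n≡[m+k]%n (x + (B ∸ y)) y B ⟩
    (x + (B ∸ y) + y) % B        ≡⟨ cong (_% B) (trans (+-assoc x _ y) (cong (x +_) (m∸n+n≡m y≤B))) ⟩
    (x + B) % B                  ≡⟨ +-B%B x x<B ⟩
    x                            ∎
    where open ≡-Reasoning

  ⊖-involutive : ∀ x y → x < B → y < B → x ⊖ (x ⊖ y) ≡ y
  ⊖-involutive x y x<B y<B = begin
    x ⊖ (x ⊖ y)          ≡⟨ cong (_⊖ (x ⊖ y)) (⊖-⊕ x y x<B (<⇒≤ y<B)) ⟨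
    x ⊖ y ⊕ y ⊖ (x ⊖ y)  ≡⟨ cong (_⊖ (x ⊖ y)) (⊕-comm (x ⊖ y) y) ⟩
    y ⊕ (x ⊖ y) ⊖ (x ⊖ y) ≡⟨ ⊕-⊖ y (x ⊖ y) y<B (<⇒≤ (⊖< x y)) ⟩
    y                    ∎
    where open ≡-Reasoning

  ⊕-cancelʳ : ∀ {x x' y} → x < B → x' < B → y < B → x ⊕ y ≡ x' ⊕ y → x ≡ x'
  ⊕-cancelʳ {x} {x'} {y} x<B x'<B y<B e =
    trans (sym (⊕-⊖ x y x<B (<⇒≤ y<B))) (trans (cong (_⊖ y) e) (⊕-⊖ x' y x'<B (<⇒≤ y<B)))

  ⊕-⊖ˡ : ∀ x y → x < B → y < B → x ⊕ y ⊖ x ≡ y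
  ⊕-⊖ˡ x y x<B y<B = trans (cong (_⊖ x) (⊕-comm x y)) (⊕-⊖ y x y<B (<⇒≤ x<B))

  ⊕-cancelˡ : ∀ {x y y'} → x < B → y < B → y' < B → x ⊕ y ≡ x ⊕ y' → y ≡ y'
  ⊕-cancelˡ {x} {y} {y'} x<B y<B y'<B e =
    trans (sym (⊕-⊖ˡ x y x<B y<B)) (trans (cong (_⊖ x) e) (⊕-⊖ˡ x y' x<B y'<B))

  countBelow-⊖ʳ : ∀ y (p : ℕ → Bool) → y < B → countBelow B (λ x → p (x ⊖ y)) ≡ countBelow B p
  countBelow-⊖ʳ y p y<B = countBelow-∘-bijection B p (_⊖ y) (_⊕ y) (λ x _ → ⊖< x y) (λ x _ → ⊕< x y)
                            (λ x x<B → ⊕-⊖ x y x<B (<⇒≤ y<B)) (λ x x<B → ⊖-⊕ x y x<B (<⇒≤ y<B))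

  countBelow-⊖ˡ : ∀ x (p : ℕ → Bool) → x < B → countBelow B (λ y → p (x ⊖ y)) ≡ countBelow B p
  countBelow-⊖ˡ x p x<B = countBelow-∘-bijection B p (x ⊖_) (x ⊖_) (λ y _ → ⊖< x y) (λ y _ → ⊖< x y)
                            (λ y y<B → ⊖-involutive x y x<B y<B) (λ y y<B → ⊖-involutive x y x<B y<B)

  outsideBand : ℕ → Edges
  outsideBand n c v = n ≤ᵇ v ⊖ c

  outsideBand-regularˡ : ∀ n c → c < B → countBelow B (outsideBand n c) ≡ B ∸ n
  outsideBand-regularˡ n c c<B = trans (countBelow-⊖ʳ c (n ≤ᵇ_) c<B) (countBelow-≤ᵇ B n)

  outsideBand-regularʳ : ∀ n v → v < B → countBelow B (transposeᴱ (outsideBand n) v) ≡ B ∸ n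
  outsideBand-regularʳ n v v<B = trans (countBelow-⊖ˡ v (n ≤ᵇ_) v<B) (countBelow-≤ᵇ B n)

-- Regular designs avoiding the short rows

-- allowed c v : value v may be used in column c of a long row.  Short row t holds c ⊕ t in column c.
record Design (a b n M : ℕ) .{{_ : NonZero b}} : Set where
  field
    allowed : Edges
    regularˡ : ∀ c → c < a → countBelow a (allowed c) ≡ M
    regularʳ : ∀ v → v < a → countBelow a (transposeᴱ allowed v) ≡ M
    avoidsShortRows : ∀ c t → c < b → t < n → allowed c (Cyclic._⊕_ b c t) ≡ false

emptyDesign : ∀ a b n .{{_ : NonZero b}} → Design a b n 0
emptyDesign a b n = record
  { allowed = λ _ _ → false
  ; regularˡ = λ _ _ → countBelow-allFalse a (λ _ _ → refl)
  ; regularʳ = λ _ _ → countBelow-allFalse a (λ _ _ → refl)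
  ; avoidsShortRows = λ _ _ _ _ → refl
  }

module Blocks (b d : ℕ) where

  blocks : Edges → Edges → Edges → Edges → Edges
  blocks TL TR BL BR c v =
    if c <ᵇ b then (if v <ᵇ b then TL c v else TR c (v ∸ b))
              else (if v <ᵇ b then BL (c ∸ b) v else BR (c ∸ b) (v ∸ b))

  module _ (TL TR BL BR : Edges) where

    blocks-top : ∀ c v → c < b → v < b → blocks TL TR BL BR c v ≡ TL c v
    blocks-top c v c<b v<b rewrite <ᵇ-complete c<b | <ᵇ-complete v<b = refl

    blocks-right : ∀ c k → c < b → blocks TL TR BL BR c (b + k) ≡ TR c k
    blocks-right c k c<b rewrite <ᵇ-complete c<b | <ᵇ-false {b + k} (m≤m+n b k) | m+n∸m≡n b k = refl

    blocks-left : ∀ k v → v < b → blocks TL TR BL BR (b + k) v ≡ BL k v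
    blocks-left k v v<b rewrite <ᵇ-false {b + k} (m≤m+n b k) | <ᵇ-complete v<b | m+n∸m≡n b k = refl

    blocks-bottom : ∀ k l → blocks TL TR BL BR (b + k) (b + l) ≡ BR k l
    blocks-bottom k l rewrite <ᵇ-false {b + k} (m≤m+n b k) | <ᵇ-false {b + l} (m≤m+n b l) | m+n∸m≡n b k | m+n∸m≡n b l = refl

    transpose-blocks : ∀ v c → transposeᴱ (blocks TL TR BL BR) v c ≡
                               blocks (transposeᴱ TL) (transposeᴱ BL) (transposeᴱ TR) (transposeᴱ BR) v c
    transpose-blocks v c with c <ᵇ b | v <ᵇ b
    ... | true | true = refl
    ... | true | false = refl
    ... | false | true = refl
    ... | false | false = refl

    blocks-regular : ∀ M → (∀ c → c < b → countBelow b (TL c) + countBelow d (TR c) ≡ M) →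
                     (∀ k → k < d → countBelow b (BL k) + countBelow d (BR k) ≡ M) →
                     ∀ c → c < b + d → countBelow (b + d) (blocks TL TR BL BR c) ≡ M
    blocks-regular M top bottom c c<b+d with c <? b
    ... | yes c<b = begin
      countBelow (b + d) (blocks TL TR BL BR c)                                          ≡⟨ countBelow-+ b d _ ⟩
      countBelow b (blocks TL TR BL BR c) + countBelow d (blocks TL TR BL BR c ∘ (b +_)) ≡⟨ cong₂ _+_
        (countBelow-cong b (λ v v<b → blocks-top c v c<b v<b)) (countBelow-cong d (λ k _ → blocks-right c k c<b)) ⟩
      countBelow b (TL c) + countBelow d (TR c)                                          ≡⟨ top c c<b ⟩
      M                                                                                  ∎
      where open ≡-Reasoning
    ... | no c≮b = subst (λ x → countBelow (b + d) (blocks TL TR BL BR x) ≡ M) (m+[n∸m]≡n b≤c) (begin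
      countBelow (b + d) (blocks TL TR BL BR (b + k))                                    ≡⟨ countBelow-+ b d _ ⟩
      countBelow b (blocks TL TR BL BR (b + k)) + countBelow d (blocks TL TR BL BR (b + k) ∘ (b +_)) ≡⟨ cong₂ _+_
        (countBelow-cong b (λ v v<b → blocks-left k v v<b)) (countBelow-cong d (λ l _ → blocks-bottom k l)) ⟩
      countBelow b (BL k) + countBelow d (BR k)                                          ≡⟨ bottom k k<d ⟩
      M                                                                                  ∎)
      where
      open ≡-Reasoning
      b≤c = ≮⇒≥ c≮b
      k = c ∸ b
      k<d : k < d
      k<d = +-cancelˡ-< b k d (subst (_< b + d) (sym (m+[n∸m]≡n b≤c)) c<b+d)

  blocks-regularʳ : ∀ M (TL TR BL BR : Edges) →
                    (∀ v → v < b → countBelow b (transposeᴱ TL v) + countBelow d (transposeᴱ BL v) ≡ M) →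
                    (∀ l → l < d → countBelow b (transposeᴱ TR l) + countBelow d (transposeᴱ BR l) ≡ M) →
                    ∀ v → v < b + d → countBelow (b + d) (transposeᴱ (blocks TL TR BL BR) v) ≡ M
  blocks-regularʳ M TL TR BL BR left right v v<b+d =
    trans (countBelow-cong (b + d) (λ c _ → transpose-blocks TL TR BL BR v c))
          (blocks-regular (transposeᴱ TL) (transposeᴱ BL) (transposeᴱ TR) (transposeᴱ BR) M left right v v<b+d)

open Blocks using (blocks; blocks-top; blocks-regular; blocks-regularʳ)

bandComplementDesign : ∀ b d n .{{_ : NonZero b}} .{{_ : NonZero d}} → n ≤ b → n ≤ d → Design (b + d) b n (b + d ∸ n)
bandComplementDesign b d n n≤b n≤d = record
  { allowed = blocks b d TL full full BR
  ; regularˡ = blocks-regular b d TL full full BR (b + d ∸ n)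
      (λ c c<b → trans (cong₂ _+_ (Cb.outsideBand-regularˡ n c c<b) (countBelow-allTrue d (λ _ _ → refl))) top)
      (λ k k<d → trans (cong₂ _+_ (countBelow-allTrue b (λ _ _ → refl)) (Cd.outsideBand-regularˡ n k k<d)) bottom)
  ; regularʳ = blocks-regularʳ b d (b + d ∸ n) TL full full BR
      (λ v v<b → trans (cong₂ _+_ (Cb.outsideBand-regularʳ n v v<b) (countBelow-allTrue d (λ _ _ → refl))) top)
      (λ l l<d → trans (cong₂ _+_ (countBelow-allTrue b (λ _ _ → refl)) (Cd.outsideBand-regularʳ n l l<d)) bottom)
  ; avoidsShortRows = λ c t c<b t<n → trans (blocks-top b d TL full full BR c (c Cb.⊕ t) c<b (Cb.⊕< c t))
                                        (trans (cong (n ≤ᵇ_) (Cb.⊕-⊖ˡ c t c<b (<-≤-trans t<n n≤b))) (≤ᵇ-false t<n))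
  }
  where
  module Cb = Cyclic b
  module Cd = Cyclic d
  TL = Cb.outsideBand n
  BR = Cd.outsideBand n
  full : Edges
  full _ _ = true
  top : b ∸ n + d ≡ b + d ∸ n
  top = sym (+-∸-comm d n≤b)
  bottom : b + (d ∸ n) ≡ b + d ∸ n
  bottom = sym (+-∸-assoc b n≤d)

module Staircase (d : ℕ) .{{_ : NonZero d}} where
  open Cyclic d

  residueCount : ℕ → ℕ → ℕ
  residueCount X j = countBelow X (λ x → x % d ≡ᵇ j)

  window : ℕ → ℕ → ℕ → Bool
  window P r j = j ⊖ (P % d) <ᵇ r

  window-size : ∀ P r → r ≤ d → countBelow d (window P r) ≡ r
  window-size P r r≤d = trans (countBelow-⊖ʳ (P % d) (_<ᵇ r) (m%n<n P d)) (countBelow-<ᵇ d r r≤d)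

  [P+k]%d≡j⇔k≡j⊖P : ∀ P k j → k < d → j < d → ((P + k) % d ≡ j → k ≡ j ⊖ (P % d)) × (k ≡ j ⊖ (P % d) → (P + k) % d ≡ j)
  [P+k]%d≡j⇔k≡j⊖P P k j k<d j<d = forward , backward
    where
    P%d<d = m%n<n P d
    shift : (P + k) % d ≡ P % d ⊕ k
    shift = sym ([m%n+k]%n≡[m+k]%n P k d)
    forward : (P + k) % d ≡ j → k ≡ j ⊖ (P % d)
    forward e = trans (sym (⊕-⊖ˡ (P % d) k P%d<d k<d)) (cong (_⊖ (P % d)) (trans (sym shift) e))
    backward : k ≡ j ⊖ (P % d) → (P + k) % d ≡ j
    backward refl = trans shift (trans (⊕-comm (P % d) _) (⊖-⊕ j (P % d) j<d (<⇒≤ P%d<d)))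

  residueCount-window : ∀ P r j → r ≤ d → j < d → countBelow r (λ k → (P + k) % d ≡ᵇ j) ≡ ind (window P r j)
  residueCount-window P r j r≤d j<d with j ⊖ (P % d) <? r
  ... | yes o<r rewrite <ᵇ-complete o<r =
    countBelow-unique r (j ⊖ (P % d)) o<r (≡ᵇ-complete (proj₂ ([P+k]%d≡j⇔k≡j⊖P P _ j (⊖< j (P % d)) j<d) refl))
      (λ k k<r e → proj₁ ([P+k]%d≡j⇔k≡j⊖P P k j (<-≤-trans k<r r≤d) j<d) (≡ᵇ-sound e))
  ... | no o≮r rewrite <ᵇ-false (≮⇒≥ o≮r) =
    countBelow-allFalse r (λ k k<r → ≡ᵇ-false λ e → o≮r (subst (_< r) (proj₁ ([P+k]%d≡j⇔k≡j⊖P P k j (<-≤-trans k<r r≤d) j<d) e) k<r))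

  residueCount-tiles : ∀ (r : ℕ → ℕ) → (∀ i → r i ≤ d) → ∀ K j → j < d →
                       countBelow K (λ i → window (sumBelow i r) (r i) j) ≡ residueCount (sumBelow K r) j
  residueCount-tiles r r≤d zero j j<d = refl
  residueCount-tiles r r≤d (suc K) j j<d = begin
    countBelow K (λ i → window (sumBelow i r) (r i) j) + ind (window (sumBelow K r) (r K) j)
      ≡⟨ cong₂ _+_ (residueCount-tiles r r≤d K j j<d) (sym (residueCount-window (sumBelow K r) (r K) j (r≤d K) j<d)) ⟩
    residueCount (sumBelow K r) j + countBelow (r K) (λ k → (sumBelow K r + k) % d ≡ᵇ j)
      ≡⟨ countBelow-+ (sumBelow K r) (r K) _ ⟨
    residueCount (sumBelow K r + r K) j
      ∎
    where open ≡-Reasoning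

  residueCount-multiple : ∀ q j → j < d → residueCount (q * d) j ≡ q
  residueCount-multiple zero j j<d = refl
  residueCount-multiple (suc q) j j<d = begin
    residueCount (d + q * d) j                                                ≡⟨ cong (λ x → residueCount x j) (+-comm d (q * d)) ⟩
    residueCount (q * d + d) j                                                ≡⟨ countBelow-+ (q * d) d _ ⟩
    residueCount (q * d) j + countBelow d (λ k → (q * d + k) % d ≡ᵇ j)        ≡⟨ cong₂ _+_ (residueCount-multiple q j j<d)
                                                                                   (residueCount-window (q * d) d j ≤-refl j<d) ⟩
    q + ind (window (q * d) d j)                                              ≡⟨ cong (λ x → q + ind x) (<ᵇ-complete (⊖< j (q * d % d))) ⟩
    q + 1                                                                     ≡⟨ +-comm q 1 ⟩
    suc q                                                                     ∎
    where open ≡-Reasoning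

countBelow-from : ∀ b n (f : ℕ → Bool) → n ≤ b → countBelow b (λ w → (n ≤ᵇ w) ∧ f w) ≡ countBelow (b ∸ n) (f ∘ (n +_))
countBelow-from b n f n≤b = begin
  countBelow b (λ w → (n ≤ᵇ w) ∧ f w)
    ≡⟨ countBelow-split _ n≤b ⟩
  countBelow n (λ w → (n ≤ᵇ w) ∧ f w) + countBelow (b ∸ n) (λ k → (n ≤ᵇ n + k) ∧ f (n + k))
    ≡⟨ cong₂ _+_ (countBelow-allFalse n (λ w w<n → cong (_∧ f w) (≤ᵇ-false w<n)))
                 (countBelow-cong (b ∸ n) (λ k _ → cong (_∧ f (n + k)) (≤ᵇ-complete (m≤m+n n k)))) ⟩
  countBelow (b ∸ n) (f ∘ (n +_))
    ∎
  where open ≡-Reasoning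

countBelow-+ind-< : ∀ L y (g : ℕ → Bool) → suc y ≤ L → countBelow L (λ k → k + ind (g k) <ᵇ suc y) ≡ suc y ∸ ind (g y)
countBelow-+ind-< L y g y<L = begin
  countBelow L F                                                              ≡⟨ cong (λ x → countBelow x F) L≡ ⟩
  countBelow (y + (1 + rest)) F                                               ≡⟨ countBelow-+ y (1 + rest) F ⟩
  countBelow y F + countBelow (1 + rest) (F ∘ (y +_))                         ≡⟨ cong (countBelow y F +_) (countBelow-+ 1 rest _) ⟩
  countBelow y F + (ind (F (y + 0)) + countBelow rest (λ k → F (y + (1 + k))))
                                                                              ≡⟨ cong₂ (λ p q → p + (ind (F (y + 0)) + q)) before after ⟩
  y + (ind (F (y + 0)) + 0)                                                   ≡⟨ cong (y +_) (trans (+-identityʳ _) (cong (ind ∘ F) (+-identityʳ y))) ⟩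
  y + ind (F y)                                                               ≡⟨ at (g y) refl ⟩
  suc y ∸ ind (g y)                                                           ∎
  where
  open ≡-Reasoning
  F : ℕ → Bool
  F k = k + ind (g k) <ᵇ suc y
  rest = L ∸ suc y
  L≡ : L ≡ y + (1 + rest)
  L≡ = trans (sym (m+[n∸m]≡n y<L)) (sym (+-suc y rest))
  before : countBelow y F ≡ y
  before = countBelow-allTrue y λ k k<y →
    <ᵇ-complete (s≤s (≤-trans (+-monoʳ-≤ k (ind≤1 (g k))) (subst (_≤ y) (+-comm 1 k) k<y)))
  after : countBelow rest (λ k → F (y + (1 + k))) ≡ 0
  after = countBelow-allFalse rest λ k _ →
    <ᵇ-false (≤-trans (≤-reflexive (+-comm 1 y)) (≤-trans (+-monoʳ-≤ y (m≤m+n 1 k)) (m≤m+n _ _)))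
  at : ∀ b → g y ≡ b → y + ind (F y) ≡ suc y ∸ ind b
  at true gy rewrite gy | <ᵇ-false {y + 1} {suc y} (≤-reflexive (+-comm 1 y)) = +-identityʳ y
  at false gy rewrite gy | +-identityʳ y | <ᵇ-complete (n<1+n y) = +-comm y 1

countBelow-band : ∀ b n y (g : ℕ → Bool) → n + suc y ≤ b →
                  countBelow b (λ w → (n ≤ᵇ w) ∧ (w ∸ n + ind (g w) <ᵇ suc y)) ≡ suc y ∸ ind (g (n + y))
countBelow-band b n y g fits = begin
  countBelow b (λ w → (n ≤ᵇ w) ∧ (w ∸ n + ind (g w) <ᵇ suc y))
    ≡⟨ countBelow-from b n _ (≤-trans (m≤m+n n _) fits) ⟩
  countBelow (b ∸ n) (λ k → n + k ∸ n + ind (g (n + k)) <ᵇ suc y)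
    ≡⟨ countBelow-cong (b ∸ n) (λ k _ → cong (λ x → x + ind (g (n + k)) <ᵇ suc y) (m+n∸m≡n n k)) ⟩
  countBelow (b ∸ n) (λ k → k + ind (g (n + k)) <ᵇ suc y)
    ≡⟨ countBelow-+ind-< (b ∸ n) y (g ∘ (n +_)) y<b∸n ⟩
  suc y ∸ ind (g (n + y))
    ∎
  where
  open ≡-Reasoning
  y<b∸n : suc y ≤ b ∸ n
  y<b∸n = subst (_≤ b ∸ n) (m+n∸m≡n n (suc y)) (∸-monoˡ-≤ n fits)

-- View allowed as a (b + d) × (b + d) 0/1 matrix.  Row c < b of its top-right block holds a run of
-- r c = ρ + [c < z] cyclically consecutive ones, the runs laid end to end; as Σ r = md, every column of the
-- block gets m ones.  Row c of the b × b corner holds the diagonals n ≤ v ⊖ c < n + m − r c, just above the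
-- forbidden ones.  Column v of the corner then has m − r (v ⊖ s) ones, s = n + m − ρ − 1 being the top
-- diagonal, so the bottom-left block is the top-right one transposed, its columns re-indexed by v ↦ v ⊖ s.
module StaircaseDesign (b d m n : ℕ) .{{_ : NonZero b}} .{{_ : NonZero d}}
                       (m≤b : m ≤ b) (d<b : d < b) (0<m : 0 < m) (fits : n + (m ∸ m * d / b) ≤ b) where
  module Cb = Cyclic b
  open Staircase d

  ρ = m * d / b
  z = m * d % b

  md≡ : m * d ≡ z + ρ * b
  md≡ = m≡m%n+[m/n]*n (m * d) b

  ρ<m : ρ < m
  ρ<m = *-cancelʳ-< b ρ m (begin-strict
    ρ * b       ≤⟨ m/n*n≤m (m * d) b ⟩
    m * d       <⟨ *-monoʳ-< m {{>-nonZero 0<m}} d<b ⟩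
    m * b       ∎)
    where open ≤-Reasoning

  y : ℕ
  y = m ∸ suc ρ

  y+ρ : suc y + ρ ≡ m
  y+ρ = trans (sym (+-suc y ρ)) (m∸n+n≡m ρ<m)

  band-fits : n + suc y ≤ b
  band-fits = subst (λ x → n + x ≤ b) (trans (cong (_∸ ρ) (sym y+ρ)) (m+n∸n≡m (suc y) ρ)) fits

  r : ℕ → ℕ
  r i = ρ + ind (i <ᵇ z)

  r≤d : ∀ i → r i ≤ d
  r≤d = bound z (subst (_≤ d * b) md≡ (≤-trans (*-monoˡ-≤ d m≤b) (≤-reflexive (*-comm b d))))
    where
    bound : ∀ z' → z' + ρ * b ≤ d * b → ∀ i → ρ + ind (i <ᵇ z') ≤ d
    bound zero h i = subst (_≤ d) (sym (+-identityʳ ρ)) (*-cancelʳ-≤ ρ d b h)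
    bound (suc z') h i = ≤-trans (+-monoʳ-≤ ρ (ind≤1 _))
      (subst (_≤ d) (+-comm 1 ρ) (*-cancelʳ-< b ρ d (<-≤-trans (s≤s (m≤n+m (ρ * b) z')) h)))

  band+run≡m : ∀ x → x ≤ 1 → (suc y ∸ x) + (ρ + x) ≡ m
  band+run≡m x x≤1 = begin
    (suc y ∸ x) + (ρ + x)   ≡⟨ cong ((suc y ∸ x) +_) (+-comm ρ x) ⟩
    (suc y ∸ x) + (x + ρ)   ≡⟨ +-assoc (suc y ∸ x) x ρ ⟨
    (suc y ∸ x) + x + ρ     ≡⟨ cong (_+ ρ) (m∸n+n≡m (≤-trans x≤1 (s≤s z≤n))) ⟩
    suc y + ρ               ≡⟨ y+ρ ⟩
    m                       ∎
    where open ≡-Reasoning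

  P : ℕ → ℕ
  P i = sumBelow i r

  P-total : P b ≡ m * d
  P-total = begin
    sumBelow b r                                               ≡⟨ sumBelow-+ b (λ _ → ρ) (λ i → ind (i <ᵇ z)) ⟩
    sumBelow b (λ _ → ρ) + sumBelow b (λ i → ind (i <ᵇ z))     ≡⟨ cong₂ _+_ (sumBelow-const b ρ) (sumBelow-ind b (_<ᵇ z)) ⟩
    b * ρ + countBelow b (_<ᵇ z)                               ≡⟨ cong₂ _+_ (*-comm b ρ) (countBelow-<ᵇ b z (<⇒≤ (m%n<n (m * d) b))) ⟩
    ρ * b + z                                                  ≡⟨ +-comm (ρ * b) z ⟩
    z + ρ * b                                                  ≡⟨ md≡ ⟨
    m * d                                                      ∎
    where open ≡-Reasoning

  staircase : Edges
  staircase i j = window (P i) (r i) j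

  staircase-regularˡ : ∀ i → countBelow d (staircase i) ≡ r i
  staircase-regularˡ i = window-size (P i) (r i) (r≤d i)

  staircase-regularʳ : ∀ j → j < d → countBelow b (transposeᴱ staircase j) ≡ m
  staircase-regularʳ j j<d = begin
    countBelow b (λ i → window (P i) (r i) j)   ≡⟨ residueCount-tiles r r≤d b j j<d ⟩
    residueCount (P b) j                       ≡⟨ cong (λ x → residueCount x j) P-total ⟩
    residueCount (m * d) j                     ≡⟨ residueCount-multiple m j j<d ⟩
    m                                          ∎
    where open ≡-Reasoning

  inBand : Bool → ℕ → Bool
  inBand x w = (n ≤ᵇ w) ∧ (w ∸ n + ind x <ᵇ suc y)

  corner : Edges
  corner c v = inBand (c <ᵇ z) (v Cb.⊖ c)

  s : ℕ
  s = n + y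

  corner-regularˡ : ∀ c → c < b → countBelow b (corner c) ≡ suc y ∸ ind (c <ᵇ z)
  corner-regularˡ c c<b = trans (Cb.countBelow-⊖ʳ c (inBand (c <ᵇ z)) c<b) (countBelow-band b n y (λ _ → c <ᵇ z) band-fits)

  corner-regularʳ : ∀ v → v < b → countBelow b (transposeᴱ corner v) ≡ suc y ∸ ind (v Cb.⊖ s <ᵇ z)
  corner-regularʳ v v<b = begin
    countBelow b (λ c → corner c v)                   ≡⟨ Cb.countBelow-⊖ˡ v (λ c → corner c v) v<b ⟨
    countBelow b (λ w → corner (v Cb.⊖ w) v)          ≡⟨ countBelow-cong b (λ w w<b → cong (inBand (v Cb.⊖ w <ᵇ z))
                                                                                      (Cb.⊖-involutive v w v<b w<b)) ⟩
    countBelow b (λ w → inBand (v Cb.⊖ w <ᵇ z) w)     ≡⟨ countBelow-band b n y (λ w → v Cb.⊖ w <ᵇ z) band-fits ⟩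
    suc y ∸ ind (v Cb.⊖ s <ᵇ z)                       ∎
    where open ≡-Reasoning

  corner-avoids : ∀ c t → c < b → t < n → corner c (c Cb.⊕ t) ≡ false
  corner-avoids c t c<b t<n rewrite Cb.⊕-⊖ˡ c t c<b (<-≤-trans t<n (≤-trans (m≤m+n n (suc y)) band-fits)) | ≤ᵇ-false t<n = refl

  design : Design (b + d) b n m
  design = record
    { allowed = blocks b d corner staircase shifted none
    ; regularˡ = blocks-regular b d corner staircase shifted none m
        (λ c c<b → trans (cong₂ _+_ (corner-regularˡ c c<b) (staircase-regularˡ c)) (band+run≡m (ind (c <ᵇ z)) (ind≤1 _)))
        (λ k k<d → trans (cong₂ _+_ (trans (Cb.countBelow-⊖ʳ s (λ i → staircase i k) (s<b)) (staircase-regularʳ k k<d))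
                                    (countBelow-allFalse d (λ _ _ → refl))) (+-identityʳ m))
    ; regularʳ = blocks-regularʳ b d m corner staircase shifted none
        (λ v v<b → trans (cong₂ _+_ (corner-regularʳ v v<b) (staircase-regularˡ (v Cb.⊖ s))) (band+run≡m (ind (v Cb.⊖ s <ᵇ z)) (ind≤1 _)))
        (λ l l<d → trans (cong₂ _+_ (staircase-regularʳ l l<d) (countBelow-allFalse d (λ _ _ → refl))) (+-identityʳ m))
    ; avoidsShortRows = λ c t c<b t<n → trans (blocks-top b d corner staircase shifted none c (c Cb.⊕ t) c<b (Cb.⊕< c t))
                                              (corner-avoids c t c<b t<n)
    }
    where
    shifted : Edges
    shifted k v = staircase (v Cb.⊖ s) k
    none : Edges
    none _ _ = false
    s<b : s < b
    s<b = <-≤-trans (+-monoʳ-< n (n<1+n y)) band-fits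

-- Latin tableaux from designs

twoSizes : ℕ → ℕ → ℕ → ℕ → List ℕ
twoSizes m a n b = replicate m a ++ replicate n b

len-++ : ∀ (xs ys : List ℕ) → len (xs ++ ys) ≡ len xs + len ys
len-++ [] ys = refl
len-++ (x ∷ xs) ys = cong suc (len-++ xs ys)

len-replicate : ∀ k x → len (replicate k x) ≡ k
len-replicate zero x = refl
len-replicate (suc k) x = cong suc (len-replicate k x)

len-twoSizes : ∀ m a n b → len (twoSizes m a n b) ≡ m + n
len-twoSizes m a n b = trans (len-++ (replicate m a) (replicate n b)) (cong₂ _+_ (len-replicate m a) (len-replicate n b))

rowLen-replicate : ∀ k x r → r < k → rowLen (replicate k x) r ≡ x
rowLen-replicate (suc k) x zero _ = refl
rowLen-replicate (suc k) x (suc r) r<k = rowLen-replicate k x r (s≤s⁻¹ r<k)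

rowLen-twoSizes-long : ∀ m a n b r → r < m → rowLen (twoSizes m a n b) r ≡ a
rowLen-twoSizes-long (suc m) a n b zero _ = refl
rowLen-twoSizes-long (suc m) a n b (suc r) r<m = rowLen-twoSizes-long m a n b r (s≤s⁻¹ r<m)

rowLen-twoSizes-short : ∀ m a n b t → t < n → rowLen (twoSizes m a n b) (m + t) ≡ b
rowLen-twoSizes-short zero a n b t t<n = rowLen-replicate n b t t<n
rowLen-twoSizes-short (suc m) a n b t t<n = rowLen-twoSizes-short m a n b t t<n

sum-map-upTo : ∀ K (F : ℕ → ℕ) → sum (map F (upTo K)) ≡ sumBelow K F
sum-map-upTo K F = go K F id
  where
  go : ∀ K (F g : ℕ → ℕ) → sum (map F (applyUpTo g K)) ≡ sumBelow K (F ∘ g)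
  go zero F g = refl
  go (suc K) F g = trans (cong (F (g 0) +_) (go K F (g ∘ suc))) (sym (sumBelow-head K (F ∘ g)))

record IsPermutation (L : ℕ) (σ : ℕ → ℕ) : Set where
  field
    σ< : ∀ c → c < L → σ c < L
    injective : ∀ c c' → c < L → c' < L → σ c ≡ σ c' → c ≡ c'
    surjective : ∀ w → w < L → ∃ λ c → c < L × σ c ≡ w

countBelow-permutation : ∀ L σ → IsPermutation L σ → ∀ w → countBelow L (λ c → σ c ≡ᵇ w) ≡ ind (w <ᵇ L)
countBelow-permutation L σ perm w with w <? L
... | yes w<L rewrite <ᵇ-complete w<L =
  let (c , c<L , σc≡w) = surjective w w<L in
  countBelow-unique L c c<L (≡ᵇ-complete σc≡w) (λ c' c'<L e → injective c' c c'<L c<L (trans (≡ᵇ-sound e) (sym σc≡w)))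
  where open IsPermutation perm
... | no w≮L rewrite <ᵇ-false (≮⇒≥ w≮L) =
  countBelow-allFalse L (λ c c<L → ≡ᵇ-false λ σc≡w → w≮L (subst (_< L) σc≡w (σ< c c<L)))
  where open IsPermutation perm

entryCount-permutations : ∀ l (σ : ℕ → ℕ → ℕ) → (∀ r → r < len l → IsPermutation (rowLen l r) (σ r)) →
                          ∀ i → 0 < i → entryCount l (λ r c → suc (σ r c)) i ≡ conjAt l i
entryCount-permutations l σ perm (suc w) _ = begin
  sum (map (λ r → countBelow (rowLen l r) (λ c → ⌊ suc (σ r c) ≟ suc w ⌋)) (upTo (len l)))
    ≡⟨ sum-map-upTo (len l) _ ⟩
  sumBelow (len l) (λ r → countBelow (rowLen l r) (λ c → ⌊ suc (σ r c) ≟ suc w ⌋))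
    ≡⟨ sumBelow-cong (len l) (λ r r<len → trans (countBelow-cong (rowLen l r) (λ c _ → isYes≗does (suc (σ r c) ≟ suc w)))
                                                (countBelow-permutation (rowLen l r) (σ r) (perm r r<len) w)) ⟩
  sumBelow (len l) (λ r → ind (w <ᵇ rowLen l r))
    ≡⟨ sumBelow-ind (len l) (λ r → suc w ≤ᵇ rowLen l r) ⟩
  conjAt l (suc w)
    ∎
  where open ≡-Reasoning

IsPermutation-cong : ∀ {L L' σ σ'} → L ≡ L' → (∀ c → σ c ≡ σ' c) → IsPermutation L σ → IsPermutation L' σ'
IsPermutation-cong {σ = σ} {σ'} refl σ≗σ' perm = record
  { σ< = λ c c<L → subst (_< _) (σ≗σ' c) (σ< c c<L)
  ; injective = λ c c' c<L c'<L e → injective c c' c<L c'<L (trans (σ≗σ' c) (trans e (sym (σ≗σ' c'))))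
  ; surjective = λ w w<L → let (c , c<L , σc≡w) = surjective w w<L in c , c<L , trans (sym (σ≗σ' c)) σc≡w
  }
  where open IsPermutation perm

module LatinFromDesign {a b n M : ℕ} .{{_ : NonZero a}} .{{_ : NonZero b}} (design : Design a b n M) where
  open Design design
  open Cyclic b

  colouring : ProperColouring a M allowed
  colouring = königColouring a M allowed (λ c c<a → ≤-reflexive (regularˡ c c<a)) (λ v v<a → ≤-reflexive (regularʳ v v<a))
  open ProperColouring colouring

  match : ℕ → ℕ → ℕ
  match α c = fromMaybe 0 (find a (hasColour colouring α c))

  match-spec : ∀ α c → α < M → c < a → match α c < a × allowed c (match α c) ≡ true × colour c (match α c) ≡ α
  match-spec α c α<M c<a with find a (hasColour colouring α c) in found
  ... | just v = let (v<a , h) = find-just a _ found ; (e , cα) = ∧≡true⇒ h in v<a , e , ≡ᵇ-sound cα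
  ... | nothing = let (v , v<a , h) = everyColour colouring c c<a (regularˡ c c<a) α α<M in
                  ⊥-elim (true≢false (trans (sym h) (find-nothing a _ found v v<a)))

  match-permutation : ∀ α → α < M → IsPermutation a (match α)
  match-permutation α α<M = record
    { σ< = λ c c<a → proj₁ (match-spec α c α<M c<a)
    ; injective = λ c c' c<a c'<a same →
        let (v<a , e , cα) = match-spec α c α<M c<a ; (_ , e' , c'α) = match-spec α c' α<M c'<a in
        properʳ c<a c'<a v<a e (subst (λ x → allowed c' x ≡ true) (sym same) e') (trans cα (sym (trans (cong (colour c') same) c'α)))
    ; surjective = λ v v<a →
        let (c , c<a , h) = everyColour (transposeColouring colouring) v v<a (regularʳ v v<a) α α<M
            (e , cα) = ∧≡true⇒ h
            (w<a , e' , c'α) = match-spec α c α<M c<a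
        in c , c<a , properˡ c<a w<a v<a e' e (trans c'α (sym (≡ᵇ-sound cα)))
    }

  shift-permutation : ∀ t → t < b → IsPermutation b (_⊕ t)
  shift-permutation t t<b = record
    { σ< = λ c _ → ⊕< c t
    ; injective = λ c c' c<b c'<b → ⊕-cancelʳ c<b c'<b t<b
    ; surjective = λ w w<b → w ⊖ t , ⊖< w t , ⊖-⊕ w t w<b (<⇒≤ t<b)
    }

  module _ (m : ℕ) (m≤M : m ≤ M) (b≤a : b ≤ a) (n≤b : n ≤ b) where

    shape : List ℕ
    shape = twoSizes m a n b

    entry : ℕ → ℕ → ℕ
    entry r c = if r <ᵇ m then match r c else c ⊕ (r ∸ m)

    data Row (r : ℕ) : Set where
      long : r < m → rowLen shape r ≡ a → (∀ c → entry r c ≡ match r c) → Row r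
      short : ∀ t → m + t ≡ r → t < n → rowLen shape r ≡ b → (∀ c → entry r c ≡ c ⊕ t) → Row r

    row : ∀ r → r < len shape → Row r
    row r r<len with r <? m
    ... | yes r<m = long r<m (rowLen-twoSizes-long m a n b r r<m) (λ c → if-true (<ᵇ-complete r<m))
    ... | no r≮m = short (r ∸ m) m+t≡r t<n (subst (λ x → rowLen shape x ≡ b) m+t≡r (rowLen-twoSizes-short m a n b (r ∸ m) t<n))
                     (λ c → if-false (<ᵇ-false (≮⇒≥ r≮m)))
      where
      m+t≡r = m+[n∸m]≡n (≮⇒≥ r≮m)
      t<n : r ∸ m < n
      t<n = +-cancelˡ-< m (r ∸ m) n (subst (_< m + n) (sym m+t≡r) (subst (r <_) (len-twoSizes m a n b) r<len))

    row-permutation : ∀ r → r < len shape → IsPermutation (rowLen shape r) (entry r)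
    row-permutation r r<len with row r r<len
    ... | long r<m rowLen≡ entry≗ =
      IsPermutation-cong (sym rowLen≡) (λ c → sym (entry≗ c)) (match-permutation r (<-≤-trans r<m m≤M))
    ... | short t _ t<n rowLen≡ entry≗ =
      IsPermutation-cong (sym rowLen≡) (λ c → sym (entry≗ c)) (shift-permutation t (<-≤-trans t<n n≤b))

    long-vs-short : ∀ {r c t} → r < m → c < b → t < n → match r c ≢ c ⊕ t
    long-vs-short {r} {c} {t} r<m c<b t<n clash =
      let (_ , e , _) = match-spec r c (<-≤-trans r<m m≤M) (<-≤-trans c<b b≤a) in
      true≢false (trans (sym e) (trans (cong (allowed c) clash) (avoidsShortRows c t c<b t<n)))

    columns-distinct : ∀ r r' c → InShape shape r c → InShape shape r' c → r ≢ r' → entry r c ≢ entry r' c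
    columns-distinct r r' c (r<len , c<) (r'<len , c<') r≢r' same with row r r<len | row r' r'<len
    ... | long r<m ℓ e | long r'<m ℓ' e' =
      let c<a = subst (c <_) ℓ c<
          (_ , _ , cr) = match-spec r c (<-≤-trans r<m m≤M) c<a
          (_ , _ , cr') = match-spec r' c (<-≤-trans r'<m m≤M) c<a
      in r≢r' (trans (sym cr) (trans (cong (colour c) (trans (sym (e c)) (trans same (e' c)))) cr'))
    ... | long r<m ℓ e | short t _ t<n ℓ' e' = long-vs-short r<m (subst (c <_) ℓ' c<') t<n (trans (sym (e c)) (trans same (e' c)))
    ... | short t _ t<n ℓ e | long r'<m ℓ' e' = long-vs-short r'<m (subst (c <_) ℓ c<) t<n (trans (sym (e' c)) (trans (sym same) (e c)))
    ... | short t m+t≡r t<n ℓ e | short t' m+t'≡r' t'<n ℓ' e' =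
      let c<b = subst (c <_) ℓ c<
          t≡t' = ⊕-cancelˡ c<b (<-≤-trans t<n n≤b) (<-≤-trans t'<n n≤b) (trans (sym (e c)) (trans same (e' c)))
      in r≢r' (trans (sym m+t≡r) (trans (cong (m +_) t≡t') m+t'≡r'))

    latin : Latin shape
    latin = T , (λ _ _ _ → s≤s z≤n) , rows-distinct , columns-distinct′ , counts
      where
      T : ℕ → ℕ → ℕ
      T r c = suc (entry r c)
      rows-distinct : ∀ r c c' → InShape shape r c → InShape shape r c' → c ≢ c' → T r c ≢ T r c'
      rows-distinct r c c' (r<len , c<) (_ , c'<) c≢c' same =
        c≢c' (IsPermutation.injective (row-permutation r r<len) c c' c< c'< (suc-injective same))
      columns-distinct′ : ∀ r r' c → InShape shape r c → InShape shape r' c → r ≢ r' → T r c ≢ T r' c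
      columns-distinct′ r r' c inShape inShape' r≢r' same = columns-distinct r r' c inShape inShape' r≢r' (suc-injective same)
      counts : ∀ i → 0 < i → entryCount shape T i ≡ conjAt shape i
      counts = entryCount-permutations shape entry row-permutation

-- Wide partitions with two part sizes

All-rowLen : ∀ {P : ℕ → Set} l r → All P l → r < len l → P (rowLen l r)
All-rowLen (x ∷ l) zero (px ∷ _) _ = px
All-rowLen (x ∷ l) (suc r) (_ ∷ pl) r<len = All-rowLen l r pl (s≤s⁻¹ r<len)

rowLen-twoSizes-≥ : ∀ m a n b r → b ≤ a → r < m + n → b ≤ rowLen (twoSizes m a n b) r
rowLen-twoSizes-≥ zero a n b r _ r<n = ≤-reflexive (sym (rowLen-replicate n b r r<n))
rowLen-twoSizes-≥ (suc m) a n b zero b≤a _ = b≤a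
rowLen-twoSizes-≥ (suc m) a n b (suc r) b≤a r<m+n = rowLen-twoSizes-≥ m a n b r b≤a (s≤s⁻¹ r<m+n)

conjAt-all : ∀ l i → (∀ r → r < len l → i ≤ rowLen l r) → conjAt l i ≡ len l
conjAt-all l i short = countBelow-allTrue (len l) (λ r r<len → ≤ᵇ-complete (short r r<len))

conjAt-twoSizes : ∀ m a n b k → k < b → b ≤ a → conjAt (twoSizes m a n b) (suc k) ≡ m + n
conjAt-twoSizes m a n b k k<b b≤a = trans (conjAt-all (twoSizes m a n b) (suc k) (λ r r<len →
  ≤-trans k<b (rowLen-twoSizes-≥ m a n b r b≤a (subst (r <_) (len-twoSizes m a n b) r<len)))) (len-twoSizes m a n b)

sum-take-map-upTo : ∀ j K (F : ℕ → ℕ) → j ≤ K → sum (take j (map F (upTo K))) ≡ sumBelow j F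
sum-take-map-upTo j K F j≤K = go j K F id j≤K
  where
  go : ∀ j K (F g : ℕ → ℕ) → j ≤ K → sum (take j (map F (applyUpTo g K))) ≡ sumBelow j (F ∘ g)
  go zero K F g _ = refl
  go (suc j) (suc K) F g j≤K = trans (cong (F (g 0) +_) (go j K F (g ∘ suc) (s≤s⁻¹ j≤K))) (sym (sumBelow-head j (F ∘ g)))

sum-take-conj : ∀ μ j → j ≤ firstPart μ → sum (take j (conj μ)) ≡ sumBelow j (λ k → conjAt μ (suc k))
sum-take-conj μ j = sum-take-map-upTo j (firstPart μ) (λ k → conjAt μ (suc k))

SelfDominant : List ℕ → Set
SelfDominant μ = Dominates μ (conj μ)

selfDominant-length : ∀ μ → IsPartition μ → SelfDominant μ → len μ ≤ firstPart μ
selfDominant-length [] _ _ = z≤n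
selfDominant-length μ@(x ∷ _) (positive , _) dominant = begin
  len μ                          ≡⟨ conjAt-all μ 1 (λ r r<len → All-rowLen μ r positive r<len) ⟨
  conjAt μ 1                     ≡⟨ sum-take-conj μ 1 (All-rowLen μ 0 positive (s≤s z≤n)) ⟨
  sum (take 1 (conj μ))          ≤⟨ dominant 1 ⟩
  x + 0                          ≡⟨ +-identityʳ x ⟩
  x                              ∎
  where open ≤-Reasoning

take-replicate-++ : ∀ m k x (ys : List ℕ) → m ≤ k → take k (replicate m x ++ ys) ≡ replicate m x ++ take (k ∸ m) ys
take-replicate-++ zero k x ys _ = refl
take-replicate-++ (suc m) (suc k) x ys m≤k = cong (x ∷_) (take-replicate-++ m k x ys (s≤s⁻¹ m≤k))

sum-replicate : ∀ k x → sum (replicate k x) ≡ k * x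
sum-replicate zero x = refl
sum-replicate (suc k) x = cong (x +_) (sum-replicate k x)

sum-take-replicate : ∀ j n x → sum (take j (replicate n x)) ≤ j * x
sum-take-replicate zero n x = z≤n
sum-take-replicate (suc j) zero x = z≤n
sum-take-replicate (suc j) (suc n) x = +-monoʳ-≤ x (sum-take-replicate j n x)

selfDominant-twoSizes : ∀ m a n b → 0 < m → m ≤ b → b ≤ a → SelfDominant (twoSizes m a n b) →
                        b * (m + n) ≤ m * a + (b ∸ m) * b
selfDominant-twoSizes m@(suc _) a n b _ m≤b b≤a dominant = begin
  b * (m + n)                                                  ≡⟨ sumBelow-const b (m + n) ⟨
  sumBelow b (λ _ → m + n)                                     ≡⟨ sumBelow-cong b (λ k k<b → conjAt-twoSizes m a n b k k<b b≤a) ⟨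
  sumBelow b (λ k → conjAt l (suc k))                          ≡⟨ sum-take-conj l b b≤a ⟨
  sum (take b (conj l))                                        ≤⟨ dominant b ⟩
  sum (take b l)                                               ≡⟨ cong sum (take-replicate-++ m b a (replicate n b) m≤b) ⟩
  sum (replicate m a ++ take (b ∸ m) (replicate n b))          ≡⟨ sum-++ (replicate m a) _ ⟩
  sum (replicate m a) + sum (take (b ∸ m) (replicate n b))     ≤⟨ +-mono-≤ (≤-reflexive (sum-replicate m a)) (sum-take-replicate (b ∸ m) n b) ⟩
  m * a + (b ∸ m) * b                                          ∎
  where
  open ≤-Reasoning
  l = twoSizes m a n b

staircase-fits : ∀ b d M N .{{_ : NonZero b}} → d ≤ b → M ≤ b → b * (M + N) ≤ M * (b + d) + (b ∸ M) * b →
                 N + (M ∸ M * d / b) ≤ b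
staircase-fits b d M N d≤b M≤b dominance = +-cancelʳ-≤ q _ _ (begin
  N + (M ∸ q) + q   ≡⟨ +-assoc N (M ∸ q) q ⟩
  N + (M ∸ q + q)   ≡⟨ cong (N +_) (m∸n+n≡m q≤M) ⟩
  N + M             ≡⟨ +-comm N M ⟩
  M + N             ≤⟨ s≤s⁻¹ (*-cancelˡ-< b (M + N) (suc q + b) below) ⟩
  q + b             ≡⟨ +-comm q b ⟩
  b + q             ∎)
  where
  open ≤-Reasoning
  q = M * d / b
  z = M * d % b
  q≤M : q ≤ M
  q≤M = *-cancelʳ-≤ q M b (≤-trans (m/n*n≤m (M * d) b) (*-monoʳ-≤ M d≤b))
  rhs : M * (b + d) + (b ∸ M) * b ≡ M * d + b * b
  rhs = subst (λ x → M * (x + d) + (x ∸ M) * x ≡ M * d + x * x) (m+[n∸m]≡n M≤b)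
          (trans (cong (λ j → M * (M + k + d) + j * (M + k)) (m+n∸m≡n M k)) (ring M k d))
    where
    k = b ∸ M
    ring : ∀ M k d → M * (M + k + d) + k * (M + k) ≡ M * d + (M + k) * (M + k)
    ring = solve-∀
  below : b * (M + N) < b * (suc q + b)
  below = begin-strict
    b * (M + N)                  ≤⟨ dominance ⟩
    M * (b + d) + (b ∸ M) * b    ≡⟨ rhs ⟩
    M * d + b * b                ≡⟨ cong (_+ b * b) (m≡m%n+[m/n]*n (M * d) b) ⟩
    z + q * b + b * b            <⟨ +-monoˡ-< (b * b) (+-monoˡ-< (q * b) (m%n<n (M * d) b)) ⟩
    b + q * b + b * b            ≡⟨ ring b q ⟨
    b * (suc q + b)              ∎
    where
    ring : ∀ b q → b * (suc q + b) ≡ b + q * b + b * b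
    ring = solve-∀

firstPart-twoSizes : ∀ {m a n b} → 0 < m → firstPart (twoSizes m a n b) ≡ a
firstPart-twoSizes {suc m} _ = refl

firstPart-replicate : ∀ k x → firstPart (replicate k x) ≤ x
firstPart-replicate zero x = z≤n
firstPart-replicate (suc k) x = ≤-refl

WideIsLatin : List ℕ → Set
WideIsLatin l = IsPartition l → Wide l → Latin l

SubMultiset-refl : ∀ l → SubMultiset l l
SubMultiset-refl l = [] , ↭-reflexive (List.++-identityʳ l)

replicate-isPartition : ∀ k x → 0 < x → IsPartition (replicate k x)
replicate-isPartition k x 0<x = All.replicate⁺ k 0<x , sorted k
  where
  sorted : ∀ k → Linked (λ x y → y ≤ x) (replicate k x)
  sorted zero = []
  sorted (suc zero) = [-]
  sorted (suc (suc k)) = ≤-refl ∷ sorted (suc k)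

latin-[] : Latin []
latin-[] = (λ _ _ → 1) , (λ _ _ _ → s≤s z≤n) , (λ { _ _ _ (() , _) }) , (λ { _ _ _ (() , _) }) , (λ _ _ → refl)

replicate-wideIsLatin : ∀ n a → WideIsLatin (replicate n a)
replicate-wideIsLatin zero a _ _ = latin-[]
replicate-wideIsLatin (suc n) zero ((() ∷ _) , _) _
replicate-wideIsLatin (suc n) a@(suc _) part wide = LatinFromDesign.latin (emptyDesign a a (suc n)) 0 z≤n ≤-refl n≤a
  where
  n≤a : suc n ≤ a
  n≤a = subst (_≤ a) (len-replicate (suc n) a) (selfDominant-length (replicate (suc n) a) part (wide _ part (SubMultiset-refl _)))

module TwoSizes (m n b d : ℕ) .{{_ : NonZero b}} .{{_ : NonZero d}} (0<m : 0 < m) where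

  a = b + d

  instance
    a-nonZero : NonZero a
    a-nonZero = >-nonZero (<-≤-trans (>-nonZero⁻¹ b) (m≤m+n b d))

  module _ (part : IsPartition (twoSizes m a n b)) (wide : Wide (twoSizes m a n b)) where

    m+n≤a : m + n ≤ a
    m+n≤a = subst₂ _≤_ (len-twoSizes m a n b) (firstPart-twoSizes 0<m)
              (selfDominant-length (twoSizes m a n b) part (wide _ part (SubMultiset-refl _)))
    
    n≤b : n ≤ b
    n≤b = subst₂ _≤_ (len-replicate n b) refl (≤-trans
            (selfDominant-length short short-isPartition (wide short short-isPartition (replicate m a , Perm.++-comm short (replicate m a))))
            (firstPart-replicate n b))
      where
      short = replicate n b
      short-isPartition = replicate-isPartition n b (>-nonZero⁻¹ b)

    wideIsLatin : Latin (twoSizes m a n b)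
    wideIsLatin with n ≤? d
    ... | yes n≤d = LatinFromDesign.latin (bandComplementDesign b d n n≤b n≤d) m m≤a∸n (m≤m+n b d) n≤b
      where
      m≤a∸n : m ≤ a ∸ n
      m≤a∸n = subst (_≤ a ∸ n) (m+n∸n≡m m n) (∸-monoˡ-≤ n m+n≤a)
    ... | no n≰d = LatinFromDesign.latin (StaircaseDesign.design b d m n m≤b d<b 0<m fits) m ≤-refl (m≤m+n b d) n≤b
      where
      d<b : d < b
      d<b = <-≤-trans (≰⇒> n≰d) n≤b
      m≤b : m ≤ b
      m≤b = <⇒≤ (+-cancelʳ-< n m b (≤-<-trans m+n≤a (+-monoʳ-< b (≰⇒> n≰d))))
      fits : n + (m ∸ m * d / b) ≤ b
      fits = staircase-fits b d m n (<⇒≤ d<b) m≤b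
               (selfDominant-twoSizes m a n b 0<m m≤b (m≤m+n b d) (wide _ part (SubMultiset-refl _)))

twoSizes-wideIsLatin : ∀ m a n b → b < a → WideIsLatin (twoSizes m a n b)
twoSizes-wideIsLatin zero a n b _ = replicate-wideIsLatin n b
twoSizes-wideIsLatin m a zero b _ = subst WideIsLatin (sym (List.++-identityʳ (replicate m a))) (replicate-wideIsLatin m a)
twoSizes-wideIsLatin (suc m) a (suc n) b b<a part wide =
  subst WideIsLatin (cong (λ x → twoSizes (suc m) x (suc n) b) (m+[n∸m]≡n (<⇒≤ b<a)))
    (TwoSizes.wideIsLatin (suc m) (suc n) b (a ∸ b) {{>-nonZero 0<b}} {{>-nonZero (m<n⇒0<n∸m b<a)}} z<s) part wide
  where
  0<b : 0 < b
  0<b = subst (0 <_) (rowLen-twoSizes-short (suc m) a (suc n) b 0 z<s)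
          (All-rowLen _ (suc m + 0) (proj₁ part) (subst (suc m + 0 <_) (sym (len-twoSizes (suc m) a (suc n) b)) (+-monoʳ-< (suc m) z<s)))

sorted-twoSizes : ∀ {A B} → B < A → ∀ l → Linked (λ x y → y ≤ x) l → All (λ x → x ≡ A ⊎ x ≡ B) l →
                  ∃₂ λ m n → l ≡ twoSizes m A n B
sorted-twoSizes B<A [] _ _ = 0 , 0 , refl
sorted-twoSizes B<A (x ∷ l) sorted (x∈ ∷ l∈) with sorted-twoSizes B<A l (Linked.tail sorted) l∈
... | m , n , refl with x∈
...   | inj₁ refl = suc m , n , refl
...   | inj₂ refl with m | sorted
...     | zero | _ = 0 , suc n , refl
...     | suc _ | B≥A ∷ _ = contradiction B≥A (<⇒≱ B<A)

constant-replicate : ∀ {A} l → All (λ x → x ≡ A ⊎ x ≡ A) l → l ≡ replicate (len l) A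
constant-replicate [] [] = refl
constant-replicate (x ∷ l) (x≡A ∷ l≡A) = cong₂ _∷_ ([ id , id ]′ x≡A) (constant-replicate l l≡A)

theorem3 : (l : List ℕ) → IsPartition l → Wide l → AtMostTwoPartSizes l → Latin l
theorem3 l part wide (A , B , parts) with <-cmp A B
... | tri≈ _ refl _ = subst WideIsLatin (sym (constant-replicate l parts)) (replicate-wideIsLatin (len l) A) part wide
... | tri> _ _ B<A = let (m , n , l≡) = sorted-twoSizes B<A l (proj₂ part) parts in
                     subst WideIsLatin (sym l≡) (twoSizes-wideIsLatin m A n B B<A) part wide
... | tri< A<B _ _ = let (m , n , l≡) = sorted-twoSizes A<B l (proj₂ part) (All.map Sum.swap parts) in
                     subst WideIsLatin (sym l≡) (twoSizes-wideIsLatin m B n A A<B) part wide
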